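{- Let $k\geq 5$, and let $C'_{k-2}$ denote the graph obtained from the cycle $C_{k-2}$ by adding a new vertex of degree one adjacent to one vertex of the cycle. Then: (1) there are exactly $k$ partitions $P$ of $V(C_k)$ with $C_k/P\cong C'_{k-2}$, and exactly $k$ partitions $P$ of $V(C_k)$ with $C_k/P\cong C_{k-2}$; (2) for every partition $P$ of $V(C_k)$ with $C_k/P\cong C'_{k-2}$ there are exactly $2$ partitions $Q$ of $V(C_k)$ such that $P$ refines $Q$ and $C_k/Q\cong C_{k-2}$, and conversely for every partition $Q$ of $V(C_k)$ with $C_k/Q\cong C_{k-2}$ there are exactly $2$ partitions $P$ of $V(C_k)$ which refine $Q$ and satisfy $C_k/P\cong C'_{k-2}$.
   Context: $C_k$ is the cycle of length $k$. For a graph $H$ and a partition $P=\{U_1,\dots,U_m\}$ of $V(H)$, the quotient graph $H/P$ has vertex set $P$, with $U_i,U_j$ adjacent (a loop if $i=j$) iff there are $u_i\in U_i,u_j\in U_j$ with $\{u_i,u_j\}\in E(H)$. A partition $P$ refines $Q$ if every part of $P$ is contained in some part of $Q$. -}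

module Defs where

open import Data.Nat using (ℕ; zero; suc; _<_; _≤ᵇ_)
open import Data.Fin using (Fin; toℕ)
open import Data.Bool using (Bool; T; not; _∨_)
open import Data.List using (map; allFin)
open import Data.Bool.ListAction using (and)
open import Data.Product using (Σ; ∃; ∃-syntax; _×_; proj₁)
open import Data.Sum using (_⊎_)
open import Function.Bundles using (_↔_; _⇔_; Inverse)
open import Relation.Binary.PropositionalEquality using (_≡_)

record Graph : Set₁ where
  field
    V   : Set
    Adj : V → V → Set
open Graph public

_≅_ : Graph → Graph → Set
G ≅ H = Σ (V G ↔ V H) λ f →
  ∀ x y → Adj G x y ⇔ Adj H (Inverse.to f x) (Inverse.to f y)

cycAdj : ℕ → ℕ → ℕ → Set
cycAdj m a b = (suc a ≡ b) ⊎ (suc b ≡ a) ⊎ (a ≡ 0 × suc b ≡ m) ⊎ (b ≡ 0 × suc a ≡ m)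

Cyc : ℕ → Graph
Cyc m = record { V = Fin m ; Adj = λ i j → cycAdj m (toℕ i) (toℕ j) }

-- C'_m : the cycle C_m on 0,…,m-1 plus a pendant vertex m adjacent to 0.
CycP : ℕ → Graph
CycP m = record
  { V = Fin (suc m)
  ; Adj = λ i j → (toℕ i < m × toℕ j < m × cycAdj m (toℕ i) (toℕ j))
                ⊎ (toℕ i ≡ 0 × toℕ j ≡ m)
                ⊎ (toℕ i ≡ m × toℕ j ≡ 0) }

record Partition (n : ℕ) : Set where
  field
    rel    : Fin n → Fin n → Bool
    reflP  : ∀ x → T (rel x x)
    symP   : ∀ {x y} → T (rel x y) → T (rel y x)
    transP : ∀ {x y z} → T (rel x y) → T (rel y z) → T (rel x z)
open Partition public

_≈P_ : ∀ {n} → Partition n → Partition n → Set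
P ≈P Q = ∀ x y → rel P x y ≡ rel Q x y

Refines : ∀ {n} → Partition n → Partition n → Set
Refines P Q = ∀ x y → T (rel P x y) → T (rel Q x y)

-- x is the least element of its part (canonical representative of the part).
isRep : ∀ {n} → Partition n → Fin n → Bool
isRep {n} P x = and (map (λ y → not (rel P y x) ∨ (toℕ x ≤ᵇ toℕ y)) (allFin n))

-- Quotient graph H/P: vertices are the parts (via their least elements);
-- parts U, W are adjacent (loop if U = W) iff some u ∈ U, w ∈ W are adjacent in H.
Quot : ∀ {n} → (Fin n → Fin n → Set) → Partition n → Graph
Quot {n} A P = record
  { V = Σ (Fin n) (λ x → T (isRep P x))
  ; Adj = λ U W → ∃[ u ] ∃[ w ] (T (rel P u (proj₁ U)) × T (rel P w (proj₁ W)) × A u w) }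

ExactlyP : ∀ {n} → ℕ → (Partition n → Set) → Set
ExactlyP {n} m Pr = Σ (Fin m → Partition n) λ f →
    (∀ i → Pr (f i))
  × (∀ i j → f i ≈P f j → i ≡ j)
  × (∀ P → Pr P → ∃[ i ] (P ≈P f i))

module Submission where

-- Write m = k - 2 and label the vertices of C_k by positions mod k. A quotient map from C_k onto C_m
-- is a closed walk of length k in C_m that uses every edge. Counting its forward steps p and backward
-- steps q gives p + q = m + 2 and p ≡ q (mod m), so either one step goes against all the others, or
-- p = q < m; in the latter case the walk lifted to ℤ stays less than m above its lowest point and misses
-- the edge below it. A single backward step at position j forces the quotient to identify exactly
-- j - 1 with j + 1 and j with j + 2: these are the k partitions of the C_m kind. For C'_m, folding the
-- pendant vertex onto a neighbour of its attachment vertex reduces to the previous case, and shows that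
-- the pendant vertex is hit exactly once, at some j, with only j - 1 and j + 1 identified. The partition
-- of C'_m kind at j then lies below exactly the C_m kind partitions at j and j - 1.

open import Defs
open import Data.Nat using (ℕ; zero; suc; _+_; _*_; _∸_; _<_; _≤_; _≡ᵇ_; z≤n; s≤s; NonZero; _%_; _/_)
open import Data.Nat.Properties
open import Data.Nat.DivMod
open import Data.Nat.Tactic.RingSolver using (solve-∀)
open import Data.Fin using (Fin; toℕ; fromℕ<) renaming (zero to fzero; suc to fsuc)
open import Data.Fin.Properties using (toℕ-injective; toℕ<n; toℕ-fromℕ<)
open import Data.Bool using (Bool; true; false; T; not; _∨_)
open import Data.Bool.Properties using (T-irrelevant; T-≡; ⇔→≡)
open import Data.List using (allFin)
open import Data.List.Relation.Unary.All.Properties using (all⁺; all⁻; tabulate⁺; tabulate⁻)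
open import Data.Product using (Σ; ∃; ∃-syntax; _×_; _,_; proj₁; proj₂; map₂)
open import Data.Sum using (_⊎_; inj₁; inj₂; [_,_]′; swap)
import Data.Sum as Sum
open import Data.Empty using (⊥; ⊥-elim)
open import Function using (_∘_; id)
open import Function.Bundles using (_⇔_; Inverse; mk↔ₛ′; mk⇔; Equivalence)
open import Relation.Binary.PropositionalEquality using (_≡_; _≢_; refl; sym; trans; cong; subst; subst₂; module ≡-Reasoning)
open import Relation.Nullary using (¬_; Dec; yes; no)
open import Relation.Nullary.Decidable using (_⊎-dec_; _×-dec_; toSum)

T-⇒ : ∀ {a b} → T (not a ∨ b) → T a → T b
T-⇒ {true} p _ = p

⇒-T : ∀ {a b} → (T a → T b) → T (not a ∨ b)
⇒-T {false} _ = _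
⇒-T {true} f = f _

T-ext : ∀ {a b} → (T a → T b) → (T b → T a) → a ≡ b
T-ext f g = ⇔→≡ {z = true} (mk⇔ (to T-≡ ∘ f ∘ from T-≡) (to T-≡ ∘ g ∘ from T-≡))
  where open Equivalence

least-witness : ∀ {n} (p : Fin n → Bool) (x : Fin n) → T (p x) →
        Σ (Fin n) λ r → T (p r) × (∀ y → T (p y) → toℕ r ≤ toℕ y)
least-witness {suc n} p x px with p fzero in eq
... | true = fzero , subst T (sym eq) _ , λ _ _ → z≤n
least-witness {suc n} p fzero px | false = ⊥-elim (subst T eq px)
least-witness {suc n} p (fsuc x) px | false with least-witness (p ∘ fsuc) x px
... | r , pr , r-min = fsuc r , pr , fsuc-min
  where
  fsuc-min : ∀ y → T (p y) → toℕ (fsuc r) ≤ toℕ y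
  fsuc-min fzero py = ⊥-elim (subst T eq py)
  fsuc-min (fsuc y) py = s≤s (r-min y py)

module Representatives {n : ℕ} (P : Partition n) where

  Part : Set
  Part = Σ (Fin n) (T ∘ isRep P)

  isRep⇒minimal : ∀ {x} → T (isRep P x) → ∀ y → T (rel P y x) → toℕ x ≤ toℕ y
  isRep⇒minimal {x} p y = ≤ᵇ⇒≤ (toℕ x) (toℕ y) ∘ T-⇒ (tabulate⁻ (all⁺ _ (allFin n) p) y)

  minimal⇒isRep : ∀ {x} → (∀ y → T (rel P y x) → toℕ x ≤ toℕ y) → T (isRep P x)
  minimal⇒isRep {x} f = all⁻ _ (tabulate⁺ λ y → ⇒-T (≤⇒≤ᵇ ∘ f y))

  isRep-unique : ∀ {x y} → T (isRep P x) → T (isRep P y) → T (rel P x y) → x ≡ y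
  isRep-unique {x} {y} px py xy =
    toℕ-injective (≤-antisym (isRep⇒minimal px y (symP P xy)) (isRep⇒minimal py x xy))

  private
    leastInPart : ∀ x → Σ (Fin n) λ r → T (rel P r x) × (∀ y → T (rel P y x) → toℕ r ≤ toℕ y)
    leastInPart x = least-witness (λ y → rel P y x) x (reflP P x)

  rep : Fin n → Fin n
  rep = proj₁ ∘ leastInPart

  rep-rel : ∀ x → T (rel P (rep x) x)
  rep-rel = proj₁ ∘ proj₂ ∘ leastInPart

  rep-isRep : ∀ x → T (isRep P (rep x))
  rep-isRep x = minimal⇒isRep λ y yr →
    proj₂ (proj₂ (leastInPart x)) y (transP P yr (rep-rel x))

  partOf : Fin n → Part
  partOf x = rep x , rep-isRep x

  Part-≡ : ∀ {x y} → x ≡ y → (p : T (isRep P x)) (q : T (isRep P y)) → (x , p) ≡ (y , q)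
  Part-≡ refl p q = cong (_ ,_) (T-irrelevant p q)

  partOf-member : ∀ (U : Part) x → T (rel P x (proj₁ U)) → partOf x ≡ U
  partOf-member (y , py) x xy =
    Part-≡ (isRep-unique (rep-isRep x) py (transP P (rep-rel x) xy)) _ _

  partOf-rel : ∀ {x y} → T (rel P x y) → partOf x ≡ partOf y
  partOf-rel {x} {y} xy = partOf-member (partOf y) x (transP P xy (symP P (rep-rel y)))

  partOf-injective : ∀ {x y} → partOf x ≡ partOf y → T (rel P x y)
  partOf-injective {x} {y} e =
    transP P (symP P (rep-rel x)) (subst (λ z → T (rel P z y)) (cong proj₁ (sym e)) (rep-rel y))

record QuotientMap {n : ℕ} (A : Fin n → Fin n → Set) (G : Graph) (P : Partition n) : Set where
  field
    map     : Fin n → V G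
    rel⇒≡   : ∀ {x y} → T (rel P x y) → map x ≡ map y
    ≡⇒rel   : ∀ {x y} → map x ≡ map y → T (rel P x y)
    hom     : ∀ {x y} → A x y → Adj G (map x) (map y)
    edge-onto : ∀ {a b} → Adj G a b → ∃[ x ] ∃[ y ] (A x y × map x ≡ a × map y ≡ b)
    onto    : ∀ a → ∃[ x ] map x ≡ a

module _ {n : ℕ} {A : Fin n → Fin n → Set} {G : Graph} {P : Partition n} where
  open Representatives P

  ≅⇒QuotientMap : Quot A P ≅ G → QuotientMap A G P
  ≅⇒QuotientMap (f , adj) = record
    { map = to ∘ partOf
    ; rel⇒≡ = cong to ∘ partOf-rel
    ; ≡⇒rel = λ e → partOf-injective (trans (sym (ft _)) (trans (cong from e) (ft _)))
    ; hom = λ {x} {y} a → Equivalence.to (adj _ _) (x , y , symP P (rep-rel x) , symP P (rep-rel y) , a)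
    ; edge-onto = edge-onto
    ; onto = λ a → proj₁ (from a) , trans (cong to (partOf-member (from a) _ (reflP P _))) (tf a)
    }
    where
    open Inverse f using (to; from)
    tf : ∀ a → to (from a) ≡ a
    tf = Inverse.strictlyInverseˡ f
    ft : ∀ U → from (to U) ≡ U
    ft = Inverse.strictlyInverseʳ f
    edge-onto : ∀ {a b} → Adj G a b → ∃[ x ] ∃[ y ] (A x y × to (partOf x) ≡ a × to (partOf y) ≡ b)
    edge-onto {a} {b} ab with Equivalence.from (adj (from a) (from b))
                          (subst₂ (Adj G) (sym (tf a)) (sym (tf b)) ab)
    ... | x , y , xa , yb , xy =
      x , y , xy , trans (cong to (partOf-member _ x xa)) (tf a)
                 , trans (cong to (partOf-member _ y yb)) (tf b)

  QuotientMap⇒≅ : QuotientMap A G P → Quot A P ≅ G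
  QuotientMap⇒≅ ψ = mk↔ₛ′ to from to-from from-to , adj
    where
    open QuotientMap ψ
    to : Part → V G
    to = map ∘ proj₁
    from : V G → Part
    from = partOf ∘ proj₁ ∘ onto
    to-from : ∀ a → to (from a) ≡ a
    to-from a = trans (rel⇒≡ (rep-rel _)) (proj₂ (onto a))
    from-to : ∀ U → from (to U) ≡ U
    from-to U = partOf-member U _ (≡⇒rel (proj₂ (onto (to U))))
    adj : ∀ U W → Adj (Quot A P) U W ⇔ Adj G (to U) (to W)
    adj U W = mk⇔ (λ { (u , w , uU , wW , uw) → subst₂ (Adj G) (rel⇒≡ uU) (rel⇒≡ wW) (hom uw) })
                  (λ ab → let x , y , xy , xa , yb = edge-onto ab in
                    x , y , ≡⇒rel xa , ≡⇒rel yb , xy)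

kernel : ∀ {n} → (Fin n → ℕ) → Partition n
kernel f = record
  { rel = λ x y → f x ≡ᵇ f y
  ; reflP = λ x → ≡⇒≡ᵇ (f x) (f x) refl
  ; symP = λ {x} {y} p → ≡⇒≡ᵇ (f y) (f x) (sym (≡ᵇ⇒≡ (f x) (f y) p))
  ; transP = λ {x} {y} {z} p q → ≡⇒≡ᵇ (f x) (f z) (trans (≡ᵇ⇒≡ (f x) (f y) p) (≡ᵇ⇒≡ (f y) (f z) q))
  }

kernel⇒≡ : ∀ {n} (f : Fin n → ℕ) {x y} → T (rel (kernel f) x y) → f x ≡ f y
kernel⇒≡ f {x} {y} = ≡ᵇ⇒≡ (f x) (f y)

≡⇒kernel : ∀ {n} (f : Fin n → ℕ) {x y} → f x ≡ f y → T (rel (kernel f) x y)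
≡⇒kernel f {x} {y} = ≡⇒≡ᵇ (f x) (f y)

module _ {n : ℕ} where

  exactly-two : ∀ {Pr : Partition n → Set} (P₀ P₁ : Partition n) → Pr P₀ → Pr P₁ → ¬ (P₀ ≈P P₁) →
                (∀ P → Pr P → P ≈P P₀ ⊎ P ≈P P₁) → ExactlyP 2 Pr
  exactly-two {Pr} P₀ P₁ pr₀ pr₁ P₀≉P₁ two = F , pr , distinct , complete
    where
    F : Fin 2 → Partition n
    F fzero = P₀
    F (fsuc _) = P₁
    pr : ∀ i → Pr (F i)
    pr fzero = pr₀
    pr (fsuc fzero) = pr₁
    distinct : ∀ i j → F i ≈P F j → i ≡ j
    distinct fzero fzero _ = refl
    distinct fzero (fsuc fzero) e = ⊥-elim (P₀≉P₁ e)
    distinct (fsuc fzero) fzero e = ⊥-elim (P₀≉P₁ λ x y → sym (e x y))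
    distinct (fsuc fzero) (fsuc fzero) _ = refl
    complete : ∀ P → Pr P → ∃[ i ] (P ≈P F i)
    complete P p with two P p
    ... | inj₁ P≈P₀ = fzero , P≈P₀
    ... | inj₂ P≈P₁ = fsuc fzero , P≈P₁

  exactly-indexed : ∀ {N} {Pr : Partition n → Set} (F : ℕ → Partition n) →
                    (∀ {c} → c < N → Pr (F c)) → (∀ {c d} → c < N → d < N → F c ≈P F d → c ≡ d) →
                    (∀ P → Pr P → ∃[ c ] (c < N × P ≈P F c)) → ExactlyP N Pr
  exactly-indexed {N} {Pr} F pr injective complete =
    F ∘ toℕ , (λ i → pr (toℕ<n i)) , (λ i j e → toℕ-injective (injective (toℕ<n i) (toℕ<n j) e)) , complete′
    where
    complete′ : ∀ P → Pr P → ∃[ i ] (P ≈P F (toℕ i))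
    complete′ P p with complete P p
    ... | c , c<N , P≈Fc = fromℕ< c<N , subst (λ d → P ≈P F d) (sym (toℕ-fromℕ< c<N)) P≈Fc

module _ (d : ℕ) .{{_ : NonZero d}} where

  [a%d+b]%d≡[a+b]%d : ∀ a b → (a % d + b) % d ≡ (a + b) % d
  [a%d+b]%d≡[a+b]%d a b = trans (%-distribˡ-+ (a % d) b d)
    (trans (cong (λ z → (z + b % d) % d) (m%n%n≡m%n a d)) (sym (%-distribˡ-+ a b d)))

  [a+b%d]%d≡[a+b]%d : ∀ a b → (a + b % d) % d ≡ (a + b) % d
  [a+b%d]%d≡[a+b]%d a b = trans (cong (_% d) (+-comm a (b % d)))
    (trans ([a%d+b]%d≡[a+b]%d b a) (cong (_% d) (+-comm b a)))

  %-congˡ-+ : ∀ a b c → a % d ≡ b % d → (a + c) % d ≡ (b + c) % d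
  %-congˡ-+ a b c e = trans (sym ([a%d+b]%d≡[a+b]%d a c))
    (trans (cong (λ z → (z + c) % d) e) ([a%d+b]%d≡[a+b]%d b c))

  %-congʳ-+ : ∀ a b c → a % d ≡ b % d → (c + a) % d ≡ (c + b) % d
  %-congʳ-+ a b c e = trans (sym ([a+b%d]%d≡[a+b]%d c a))
    (trans (cong (λ z → (c + z) % d) e) ([a+b%d]%d≡[a+b]%d c b))

  +-cancelˡ-% : ∀ c {a b} → (c + a) % d ≡ (c + b) % d → a % d ≡ b % d
  +-cancelˡ-% c {a} {b} e = trans (sym (cancel a)) (trans (cong (λ z → (t + z) % d) e) (cancel b))
    where
    open ≡-Reasoning
    t : ℕ
    t = d ∸ c % d
    cancel : ∀ x → (t + (c + x) % d) % d ≡ x % d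
    cancel x = begin
      (t + (c + x) % d) % d     ≡⟨ [a+b%d]%d≡[a+b]%d t (c + x) ⟩
      (t + (c + x)) % d         ≡⟨ %-congʳ-+ (c % d + x) (c + x) t ([a%d+b]%d≡[a+b]%d c x) ⟨
      (t + (c % d + x)) % d     ≡⟨ cong (_% d) (+-assoc t (c % d) x) ⟨
      (t + c % d + x) % d       ≡⟨ cong (λ z → (z + x) % d) (m∸n+n≡m (m%n≤n c d)) ⟩
      (d + x) % d               ≡⟨ cong (_% d) (+-comm d x) ⟩
      (x + d) % d               ≡⟨ [m+n]%n≡m%n x d ⟩
      x % d                     ∎

  %-injective : ∀ {a b} → a < d → b < d → a % d ≡ b % d → a ≡ b
  %-injective a<d b<d e = trans (sym (m<n⇒m%n≡m a<d)) (trans e (m<n⇒m%n≡m b<d))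

cycAdj-sym : ∀ {M a b} → cycAdj M a b → cycAdj M b a
cycAdj-sym (inj₁ e) = inj₂ (inj₁ e)
cycAdj-sym (inj₂ (inj₁ e)) = inj₁ e
cycAdj-sym (inj₂ (inj₂ (inj₁ e))) = inj₂ (inj₂ (inj₂ e))
cycAdj-sym (inj₂ (inj₂ (inj₂ e))) = inj₂ (inj₂ (inj₁ e))

Forward : ℕ → ℕ → ℕ → Set
Forward M a b = (suc a ≡ b) ⊎ (b ≡ 0 × suc a ≡ M)

cycAdj⇒Forward : ∀ {M a b} → cycAdj M a b → Forward M a b ⊎ Forward M b a
cycAdj⇒Forward (inj₁ e) = inj₁ (inj₁ e)
cycAdj⇒Forward (inj₂ (inj₁ e)) = inj₂ (inj₁ e)
cycAdj⇒Forward (inj₂ (inj₂ (inj₁ e))) = inj₂ (inj₂ e)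
cycAdj⇒Forward (inj₂ (inj₂ (inj₂ e))) = inj₁ (inj₂ e)

Forward⇒cycAdj : ∀ {M a b} → Forward M a b → cycAdj M a b
Forward⇒cycAdj (inj₁ e) = inj₁ e
Forward⇒cycAdj (inj₂ e) = inj₂ (inj₂ (inj₂ e))

pendAdj : ℕ → ℕ → ℕ → Set
pendAdj M a b = (a < M × b < M × cycAdj M a b) ⊎ (a ≡ 0 × b ≡ M) ⊎ (a ≡ M × b ≡ 0)

pendAdj-sym : ∀ {M a b} → pendAdj M a b → pendAdj M b a
pendAdj-sym (inj₁ (a<M , b<M , ab)) = inj₁ (b<M , a<M , cycAdj-sym ab)
pendAdj-sym (inj₂ (inj₁ (p , q))) = inj₂ (inj₂ (q , p))
pendAdj-sym (inj₂ (inj₂ (p , q))) = inj₂ (inj₁ (q , p))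

module Cycle (n : ℕ) where

  m : ℕ
  m = suc (suc (suc n))

  k : ℕ
  k = suc (suc m)

  -- Vertices of C_k are positions 0, …, k - 1: x ⊕ a is x + a and offset j x is x - j, both mod k.
  _⊕_ : ℕ → ℕ → ℕ
  x ⊕ a = (a + x) % k

  offset : ℕ → ℕ → ℕ
  offset j x = ((k ∸ j) + x) % k

  ⊕-<k : ∀ x a → x ⊕ a < k
  ⊕-<k x a = m%n<n (a + x) k

  offset-<k : ∀ j x → offset j x < k
  offset-<k j x = m%n<n ((k ∸ j) + x) k

  ⊕-⊕ : ∀ x a b → (x ⊕ a) ⊕ b ≡ x ⊕ (b + a)
  ⊕-⊕ x a b = trans ([a+b%d]%d≡[a+b]%d k b (a + x)) (cong (_% k) (sym (+-assoc b a x)))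

  offset-⊕ : ∀ j x a → offset j (x ⊕ a) ≡ offset j x ⊕ a
  offset-⊕ j x a = begin
    ((k ∸ j) + (a + x) % k) % k  ≡⟨ [a+b%d]%d≡[a+b]%d k (k ∸ j) (a + x) ⟩
    ((k ∸ j) + (a + x)) % k      ≡⟨ cong (_% k) (x+[y+z]≡y+[x+z] (k ∸ j) a x) ⟩
    (a + ((k ∸ j) + x)) % k      ≡⟨ [a+b%d]%d≡[a+b]%d k a ((k ∸ j) + x) ⟨
    (a + offset j x) % k         ∎
    where
    open ≡-Reasoning
    x+[y+z]≡y+[x+z] : ∀ x y z → x + (y + z) ≡ y + (x + z)
    x+[y+z]≡y+[x+z] = solve-∀

  private
    k∸j+j : ∀ {j} x → j ≤ k → (k ∸ j) + (j + x) ≡ x + k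
    k∸j+j {j} x j≤k = trans (sym (+-assoc (k ∸ j) j x)) (trans (cong (_+ x) (m∸n+n≡m j≤k)) (+-comm k x))

  offset-⊕-cancel : ∀ {j r} → j ≤ k → r < k → offset j (j ⊕ r) ≡ r
  offset-⊕-cancel {j} {r} j≤k r<k = trans ([a+b%d]%d≡[a+b]%d k (k ∸ j) (r + j))
    (trans (cong (λ z → ((k ∸ j) + z) % k) (+-comm r j))
    (trans (cong (_% k) (k∸j+j r j≤k)) (trans ([m+n]%n≡m%n r k) (m<n⇒m%n≡m r<k))))

  offset+j : ∀ {j} x → j ≤ k → (offset j x + j) % k ≡ x % k
  offset+j {j} x j≤k = trans ([a%d+b]%d≡[a+b]%d k ((k ∸ j) + x) j)
    (trans (cong (_% k) (trans (+-assoc (k ∸ j) x j) (cong ((k ∸ j) +_) (+-comm x j))))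
    (trans (cong (_% k) (k∸j+j x j≤k)) ([m+n]%n≡m%n x k)))

  ⊕-offset-cancel : ∀ {j x} → j ≤ k → x < k → j ⊕ offset j x ≡ x
  ⊕-offset-cancel {j} {x} j≤k x<k = trans (offset+j x j≤k) (m<n⇒m%n≡m x<k)

  ⊕-% : ∀ c a → c ⊕ a ≡ c ⊕ (a % k)
  ⊕-% c a = sym ([a%d+b]%d≡[a+b]%d k a c)

  ⊕0 : ∀ {c} → c < k → c ⊕ 0 ≡ c
  ⊕0 = m<n⇒m%n≡m

  ⊕k : ∀ {c} → c < k → c ⊕ k ≡ c
  ⊕k {c} c<k = trans (⊕-% c k) (trans (cong (c ⊕_) (n%n≡0 k)) (⊕0 c<k))

  ⊕-injectiveˡ : ∀ {i j} r → i < k → j < k → i ⊕ r ≡ j ⊕ r → i ≡ j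
  ⊕-injectiveˡ r i<k j<k e = %-injective k i<k j<k (+-cancelˡ-% k r e)

  ⊕-injectiveʳ : ∀ c {a b} → a < k → b < k → c ⊕ a ≡ c ⊕ b → a ≡ b
  ⊕-injectiveʳ c {a} {b} a<k b<k e = %-injective k a<k b<k
    (+-cancelˡ-% k c (trans (cong (_% k) (+-comm c a)) (trans e (cong (_% k) (+-comm b c)))))

  offset-injectiveˡ : ∀ {i j x} → i < k → j < k → x < k → offset i x ≡ offset j x → i ≡ j
  offset-injectiveˡ {i} {j} {x} i<k j<k x<k e = ⊕-injectiveˡ (offset j x) i<k j<k
    (trans (cong (i ⊕_) (sym e))
        (trans (⊕-offset-cancel (<⇒≤ i<k) x<k) (sym (⊕-offset-cancel (<⇒≤ j<k) x<k))))

  cycAdj-⊕1 : ∀ {x} → x < k → cycAdj k x (x ⊕ 1)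
  cycAdj-⊕1 x<k with m≤n⇒m<n∨m≡n x<k
  ... | inj₁ 1+x<k = inj₁ (sym (m<n⇒m%n≡m 1+x<k))
  ... | inj₂ refl = inj₂ (inj₂ (inj₂ (n%n≡0 k , refl)))

  cycAdj⇒⊕1 : ∀ {x y} → x < k → y < k → cycAdj k x y → (y ≡ x ⊕ 1) ⊎ (x ≡ y ⊕ 1)
  cycAdj⇒⊕1 x<k y<k (inj₁ refl) = inj₁ (sym (m<n⇒m%n≡m y<k))
  cycAdj⇒⊕1 x<k y<k (inj₂ (inj₁ refl)) = inj₂ (sym (m<n⇒m%n≡m x<k))
  cycAdj⇒⊕1 x<k y<k (inj₂ (inj₂ (inj₁ (refl , refl)))) = inj₂ (sym (n%n≡0 k))
  cycAdj⇒⊕1 x<k y<k (inj₂ (inj₂ (inj₂ (refl , refl)))) = inj₁ (sym (n%n≡0 k))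

  SameEdge : ℕ → ℕ → ℕ → ℕ → Set
  SameEdge x y a b = (x ≡ a × y ≡ b) ⊎ (x ≡ b × y ≡ a)

  -- The canonical quotient maps, on positions counted from the fold. toCyc runs 1, 0, 1, 2, …, m - 1, 0,
  -- identifying positions 0 with 2 and 1 with k - 1; toCycP runs m, 0, 1, 2, …, m - 1, 0, where m is the
  -- pendant vertex, identifying only 1 with k - 1.
  toCyc : ℕ → ℕ
  toCyc zero = 1
  toCyc (suc r) = r % m

  toCycP : ℕ → ℕ
  toCycP zero = m
  toCycP (suc r) = r % m

  toCyc-<m : ∀ r → toCyc r < m
  toCyc-<m zero = s≤s (s≤s z≤n)
  toCyc-<m (suc r) = m%n<n r m

  toCycP-≤m : ∀ r → toCycP r < suc m
  toCycP-≤m zero = ≤-refl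
  toCycP-≤m (suc r) = m≤n⇒m≤1+n (m%n<n r m)

  data Position : ℕ → Set where
    first  : Position 0
    middle : ∀ r → r < m → Position (suc r)
    last   : Position (suc m)

  position : ∀ {r} → r < k → Position r
  position {zero} _ = first
  position {suc r} (s≤s r≤m) with m≤n⇒m<n∨m≡n r≤m
  ... | inj₁ r<m = middle r (≤-pred r<m)
  ... | inj₂ refl = last

  ⊕1-< : ∀ {r} → suc r < k → r ⊕ 1 ≡ suc r
  ⊕1-< = m<n⇒m%n≡m

  last⊕1 : suc m ⊕ 1 ≡ 0
  last⊕1 = n%n≡0 k

  ⊕2-< : ∀ {r} → suc (suc r) < k → r ⊕ 2 ≡ suc (suc r)
  ⊕2-< = m<n⇒m%n≡m

  last⊕2 : suc m ⊕ 2 ≡ 1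
  last⊕2 = [m+n]%n≡m%n 1 k

  m%m≡0 : m % m ≡ 0
  m%m≡0 = n%n≡0 m

  Forward⇒≡suc% : ∀ {a b} → b < m → Forward m a b → b ≡ suc a % m
  Forward⇒≡suc% b<m (inj₁ refl) = sym (m<n⇒m%n≡m b<m)
  Forward⇒≡suc% b<m (inj₂ (refl , e)) = sym (trans (cong (_% m) e) m%m≡0)

  ≤m-%-≡ : ∀ {a b} → a ≤ m → b ≤ m → a % m ≡ b % m → a ≡ b ⊎ (a ≡ 0 × b ≡ m) ⊎ (a ≡ m × b ≡ 0)
  ≤m-%-≡ a≤m b≤m e with m≤n⇒m<n∨m≡n a≤m | m≤n⇒m<n∨m≡n b≤m
  ... | inj₁ a<m | inj₁ b<m = inj₁ (%-injective m a<m b<m e)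
  ... | inj₁ a<m | inj₂ refl = inj₂ (inj₁ (trans (sym (m<n⇒m%n≡m a<m)) (trans e m%m≡0) , refl))
  ... | inj₂ refl | inj₁ b<m = inj₂ (inj₂ (refl , trans (sym (m<n⇒m%n≡m b<m)) (trans (sym e) m%m≡0)))
  ... | inj₂ refl | inj₂ refl = inj₁ refl

  toCyc-hom : ∀ {r} → r < k → cycAdj m (toCyc r) (toCyc (r ⊕ 1))
  toCyc-hom r<k with position r<k
  ... | first = inj₂ (inj₁ refl)
  ... | last = subst₂ (cycAdj m) (sym m%m≡0) (cong toCyc (sym last⊕1)) (inj₁ refl)
  ... | middle r r<m = subst (cycAdj m (r % m)) (cong toCyc (sym (⊕1-< (s≤s (s≤s r<m)))))
                         (subst (λ z → cycAdj m z (suc r % m)) (sym (m<n⇒m%n≡m r<m))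
                           (Forward⇒cycAdj (fwd (m≤n⇒m<n∨m≡n r<m))))
    where
    fwd : suc r < m ⊎ suc r ≡ m → Forward m r (suc r % m)
    fwd (inj₁ 1+r<m) = inj₁ (sym (m<n⇒m%n≡m 1+r<m))
    fwd (inj₂ e) = inj₂ (trans (cong (_% m) e) m%m≡0 , e)

  forward-crossing : (f : ℕ → ℕ) → (∀ r → f (suc r) ≡ r % m) → ∀ {a b} → a < m → b < m → Forward m a b →
                     f (suc a) ≡ a × f (suc a ⊕ 1) ≡ b
  forward-crossing f f-suc {a} a<m b<m a→b = trans (f-suc a) (m<n⇒m%n≡m a<m) ,
    trans (cong f (⊕1-< (s≤s (s≤s a<m)))) (trans (f-suc (suc a)) (sym (Forward⇒≡suc% b<m a→b)))

  cycEdge-onto : (f : ℕ → ℕ) → (∀ r → f (suc r) ≡ r % m) → ∀ {a b} → a < m → b < m → cycAdj m a b →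
                 ∃[ r ] (r < k × SameEdge (f r) (f (r ⊕ 1)) a b)
  cycEdge-onto f f-suc {a} {b} a<m b<m ab with cycAdj⇒Forward ab
  ... | inj₁ a→b = suc a , s≤s (m≤n⇒m≤1+n a<m) , inj₁ (forward-crossing f f-suc a<m b<m a→b)
  ... | inj₂ b→a = suc b , s≤s (m≤n⇒m≤1+n b<m) , inj₂ (forward-crossing f f-suc b<m a<m b→a)

  toCyc-onto : ∀ {a} → a < m → ∃[ r ] (r < k × toCyc r ≡ a)
  toCyc-onto {a} a<m = suc a , s≤s (s≤s (<⇒≤ a<m)) , m<n⇒m%n≡m a<m

  toCyc≡toCycP : ∀ {r} → 0 < r → toCyc r ≡ toCycP r
  toCyc≡toCycP {suc r} _ = refl

  toCycP-hom : ∀ {r} → r < k → pendAdj m (toCycP r) (toCycP (r ⊕ 1))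
  toCycP-hom r<k with position r<k
  ... | first = inj₂ (inj₂ (refl , refl))
  ... | last = inj₂ (inj₁ (m%m≡0 , cong toCycP last⊕1))
  ... | middle r r<m = inj₁ (m%n<n r m , subst (_< m) e (toCyc-<m (suc r ⊕ 1)) ,
                         subst (cycAdj m (r % m)) e (toCyc-hom {suc r} (s≤s (m≤n⇒m≤1+n r<m))))
    where
    e : toCyc (suc r ⊕ 1) ≡ toCycP (suc r ⊕ 1)
    e = toCyc≡toCycP (subst (0 <_) (sym (⊕1-< (s≤s (s≤s r<m)))) (s≤s z≤n))

  toCycP-edge-onto : ∀ {a b} → a < suc m → b < suc m → pendAdj m a b →
                     ∃[ r ] (r < k × SameEdge (toCycP r) (toCycP (r ⊕ 1)) a b)
  toCycP-edge-onto _ _ (inj₁ (a<m , b<m , ab)) = cycEdge-onto toCycP (λ _ → refl) a<m b<m ab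
  toCycP-edge-onto _ _ (inj₂ (inj₁ (refl , refl))) = suc m , ≤-refl , inj₁ (m%m≡0 , cong toCycP last⊕1)
  toCycP-edge-onto _ _ (inj₂ (inj₂ (refl , refl))) = 0 , s≤s z≤n , inj₁ (refl , refl)

  toCycP-onto : ∀ {a} → a < suc m → ∃[ r ] (r < k × toCycP r ≡ a)
  toCycP-onto a≤m with m≤n⇒m<n∨m≡n a≤m
  ... | inj₁ (s≤s a<m) = suc _ , s≤s (s≤s (<⇒≤ a<m)) , m<n⇒m%n≡m a<m
  ... | inj₂ refl = 0 , s≤s z≤n , refl

  2%m≢0 : 2 % m ≢ 0
  2%m≢0 ()

  toCyc-suc⊕2 : ∀ {r} → r < m → toCyc (suc r ⊕ 2) ≡ (2 + r) % m
  toCyc-suc⊕2 {r} r<m with m≤n⇒m<n∨m≡n r<m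
  ... | inj₁ 1+r<m = cong toCyc (⊕2-< (s≤s (s≤s 1+r<m)))
  ... | inj₂ refl = trans (cong toCyc (n%n≡0 k)) (sym ([m+n]%n≡m%n 1 m))

  toCyc-fold : ∀ {r} → r < k → toCyc r ≡ toCyc (r ⊕ 2) → r ≡ suc m ⊎ r ≡ 0
  toCyc-fold r<k e with position r<k
  ... | first = inj₂ refl
  ... | last = inj₁ refl
  ... | middle r r<m = ⊥-elim (2%m≢0 (sym (+-cancelˡ-% m r (trans (cong (_% m) (+-identityʳ r))
                         (trans e (trans (toCyc-suc⊕2 r<m) (cong (_% m) (+-comm 2 r))))))))

  toCycP-fold : ∀ {r} → r < k → toCycP r ≡ toCycP (r ⊕ 2) → r ≡ suc m
  toCycP-fold r<k e with position r<k
  ... | first = ⊥-elim (m≢1 e)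
    where
    m≢1 : m ≢ 1
    m≢1 ()
  ... | last = refl
  ... | middle r r<m with suc r ⊕ 2 in eq
  ...   | zero = ⊥-elim (<⇒≢ (m%n<n r m) e)
  ...   | suc s = [ id , (λ ()) ]′ (toCyc-fold r<k (trans e (cong toCyc (sym eq))))

  toCycP⇒toCyc : ∀ r s → toCycP r ≡ toCycP s → toCyc r ≡ toCyc s
  toCycP⇒toCyc zero zero e = refl
  toCycP⇒toCyc zero (suc s) e = ⊥-elim (<⇒≢ (m%n<n s m) (sym e))
  toCycP⇒toCyc (suc r) zero e = ⊥-elim (<⇒≢ (m%n<n r m) e)
  toCycP⇒toCyc (suc r) (suc s) e = e

-- Abstract because with-abstraction over least-difference ups downs k would otherwise unfold it along
-- the known successors of k, with ups and downs unfolding at every step, and exhaust memory.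
abstract
  least-difference : (f g : ℕ → ℕ) → ∀ N → ∃[ x₀ ] (x₀ ≤ N × (∀ x → x ≤ N → f x₀ + g x ≤ f x + g x₀))
  least-difference f g zero = 0 , z≤n , λ { .0 z≤n → ≤-refl }
  least-difference f g (suc N) with least-difference f g N
  ... | x₀ , x₀≤N , x₀-least with f x₀ + g (suc N) ≤? f (suc N) + g x₀
  ...   | yes le = x₀ , m≤n⇒m≤1+n x₀≤N , least
    where
    least : ∀ x → x ≤ suc N → f x₀ + g x ≤ f x + g x₀
    least x x≤1+N with m≤n⇒m<n∨m≡n x≤1+N
    ... | inj₁ (s≤s x≤N) = x₀-least x x≤N
    ... | inj₂ refl = le
  ...   | no gt = suc N , ≤-refl , least
    where
    lt : f (suc N) + g x₀ ≤ f x₀ + g (suc N)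
    lt = <⇒≤ (≰⇒> gt)
    least : ∀ x → x ≤ suc N → f (suc N) + g x ≤ f x + g (suc N)
    least x x≤1+N with m≤n⇒m<n∨m≡n x≤1+N
    ... | inj₁ (s≤s x≤N) = +-cancelʳ-≤ (f x₀ + g x₀) _ _
             (subst₂ _≤_ (shuffle (f (suc N)) (g x) (f x₀) (g x₀)) (shuffle′ (f x) (g (suc N)) (f x₀) (g x₀))
               (+-mono-≤ lt (x₀-least x x≤N)))
      where
      shuffle : ∀ a b c d → a + d + (c + b) ≡ a + b + (c + d)
      shuffle = solve-∀
      shuffle′ : ∀ a b c d → c + b + (a + d) ≡ a + b + (c + d)
      shuffle′ = solve-∀
    ... | inj₂ refl = ≤-refl

module Walks (n : ℕ) where
  open Cycle n

  record ClosedWalk (N : ℕ) (E : ℕ → ℕ → Set) (u : ℕ → ℕ) : Set where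
    field
      bounded  : ∀ x → u x < N
      periodic : ∀ x → u (x + k) ≡ u x
      step     : ∀ x → E (u x) (u (suc x))

  CoversCycle : (ℕ → ℕ) → Set
  CoversCycle u = ∀ {a b} → a < m → b < m → cycAdj m a b → ∃[ t ] SameEdge (u t) (u (suc t)) a b

  SameKernel : (ℕ → ℕ) → (ℕ → ℕ) → Set
  SameKernel u f = ∀ {x y} → x < k → y < k → (u x ≡ u y → f x ≡ f y) × (f x ≡ f y → u x ≡ u y)

  periodic-% : ∀ {u : ℕ → ℕ} → (∀ x → u (x + k) ≡ u x) → ∀ x → u x ≡ u (x % k)
  periodic-% {u} periodic x = trans (cong u (m≡m%n+[m/n]*n x k)) (periods (x % k) (x / k))
    where
    periods : ∀ a q → u (a + q * k) ≡ u a
    periods a zero = cong u (+-identityʳ a)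
    periods a (suc q) = trans (cong u (shuffle a q k)) (trans (periodic (a + q * k)) (periods a q))
      where
      shuffle : ∀ a q k → a + (k + q * k) ≡ a + q * k + k
      shuffle = solve-∀

  forward? : ∀ a b → Dec (Forward m a b)
  forward? a b = (suc a ≟ b) ⊎-dec ((b ≟ 0) ×-dec (suc a ≟ m))

  Forward-asym : ∀ {a b} → Forward m a b → ¬ Forward m b a
  Forward-asym (inj₁ refl) (inj₁ e) = m≢1+n+m _ {1} (sym e)
  Forward-asym (inj₁ refl) (inj₂ (refl , ()))
  Forward-asym (inj₂ (refl , ())) (inj₁ refl)
  Forward-asym (inj₂ (refl , e)) (inj₂ (refl , ()))

  ¬Forward⇒Forward : ∀ {a b} → cycAdj m a b → ¬ Forward m a b → Forward m b a
  ¬Forward⇒Forward ab ¬a→b with cycAdj⇒Forward ab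
  ... | inj₁ a→b = ⊥-elim (¬a→b a→b)
  ... | inj₂ b→a = b→a

  Forward⇒% : ∀ {a b} → b < m → Forward m a b → b % m ≡ suc a % m
  Forward⇒% {a} b<m a→b = trans (cong (_% m) (Forward⇒≡suc% b<m a→b)) (m%n%n≡m%n (suc a) m)

  two-steps≢ : ∀ {a p} → p < m → a % m ≡ suc p % m → (a + 1) % m ≢ p
  two-steps≢ {a} {p} p<m a≡1+p e = 2%m≢0 (+-cancelˡ-% m p (begin
    (p + 2) % m          ≡⟨ cong (_% m) (+-suc p 1) ⟩
    (suc p + 1) % m      ≡⟨ [a%d+b]%d≡[a+b]%d m (suc p) 1 ⟨
    (suc p % m + 1) % m  ≡⟨ cong (λ z → (z + 1) % m) a≡1+p ⟨
    (a % m + 1) % m      ≡⟨ [a%d+b]%d≡[a+b]%d m a 1 ⟩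
    (a + 1) % m          ≡⟨ e ⟩
    p                    ≡⟨ m<n⇒m%n≡m p<m ⟨
    p % m                ≡⟨ cong (_% m) (+-identityʳ p) ⟨
    (p + 0) % m          ∎))
    where open ≡-Reasoning

  cycPred : ℕ → ℕ
  cycPred zero = m ∸ 1
  cycPred (suc a) = a

  cycPred-forward : ∀ a → Forward m (cycPred a) a
  cycPred-forward zero = inj₂ (refl , refl)
  cycPred-forward (suc a) = inj₁ refl

  cycPred-<m : ∀ {a} → a < m → cycPred a < m
  cycPred-<m {zero} _ = ≤-refl
  cycPred-<m {suc a} a<m = <⇒≤ a<m

  private
    both-≥2 : ∀ p q → suc (suc p) + q ≡ m → suc (suc p) % m ≡ suc (suc q) % m →
               suc (suc p) ≡ suc (suc q) × suc (suc p) < m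
    both-≥2 p q e e% with ≤m-%-≡ {suc (suc p)} {suc (suc q)} (subst (suc (suc p) ≤_) e (m≤m+n _ q))
                                                  (subst (suc (suc q) ≤_) e (+-monoˡ-≤ q (s≤s (s≤s z≤n)))) e%
    ... | inj₂ (inj₁ (() , _))
    ... | inj₂ (inj₂ (_ , ()))
    ... | inj₁ refl = refl , ≤∧≢⇒< (subst (suc (suc p) ≤_) e (m≤m+n _ p)) (P≢m p e)
      where
      P≢m : ∀ p → suc (suc p) + p ≡ m → suc (suc p) ≢ m
      P≢m zero _ ()
      P≢m (suc p) e P≡m = m+1+n≢m (suc (suc (suc p))) (trans e (sym P≡m))

  winding-cases : ∀ p q → p + q ≡ k → q % m ≡ p % m → q ≡ 1 ⊎ p ≡ 1 ⊎ (p ≡ q × p < m)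
  winding-cases p zero e e% with trans (sym (+-identityʳ p)) e
  ... | refl = ⊥-elim (2%m≢0 (trans (sym ([m+n]%n≡m%n 2 m)) (sym e%)))
  winding-cases p (suc zero) _ _ = inj₁ refl
  winding-cases zero (suc (suc q)) refl e% = ⊥-elim (2%m≢0 (trans (sym ([m+n]%n≡m%n 2 m)) e%))
  winding-cases (suc zero) (suc (suc q)) _ _ = inj₂ (inj₁ refl)
  winding-cases (suc (suc p)) (suc (suc q)) e e% = inj₂ (inj₂ (both-≥2 p q P+q≡m (sym e%)))
    where
    P+q≡m : suc (suc p) + q ≡ m
    P+q≡m = suc-injective (suc-injective
      (trans (sym (trans (+-suc (suc (suc p)) (suc q)) (cong suc (+-suc (suc (suc p)) q)))) e))

  module Winding {u : ℕ → ℕ} (w : ClosedWalk m (cycAdj m) u) where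
    open ClosedWalk w

    Fwd : ℕ → Set
    Fwd t = Forward m (u t) (u (suc t))

    ups downs : ℕ → ℕ
    ups zero = 0
    ups (suc x) with forward? (u x) (u (suc x))
    ... | yes _ = suc (ups x)
    ... | no _ = ups x
    downs zero = 0
    downs (suc x) with forward? (u x) (u (suc x))
    ... | yes _ = downs x
    ... | no _ = suc (downs x)

    ups+downs : ∀ x → ups x + downs x ≡ x
    ups+downs zero = refl
    ups+downs (suc x) with forward? (u x) (u (suc x))
    ... | yes _ = cong suc (ups+downs x)
    ... | no _ = trans (+-suc (ups x) (downs x)) (cong suc (ups+downs x))

    -- u x ≡ u 0 + ups x - downs x (mod m), moved around so that nothing is subtracted.
    winding : ∀ x → (u x + downs x) % m ≡ (u 0 + ups x) % m
    winding zero = refl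
    winding (suc x) with forward? (u x) (u (suc x))
    ... | yes x→ = begin
        (u (suc x) + downs x) % m
          ≡⟨ %-congˡ-+ m (u (suc x)) (suc (u x)) (downs x) (Forward⇒% (bounded (suc x)) x→) ⟩
        (suc (u x) + downs x) % m   ≡⟨ %-congʳ-+ m (u x + downs x) (u 0 + ups x) 1 (winding x) ⟩
        (suc (u 0 + ups x)) % m     ≡⟨ cong (_% m) (+-suc (u 0) (ups x)) ⟨
        (u 0 + suc (ups x)) % m     ∎
      where open ≡-Reasoning
    ... | no ¬x→ = begin
        (u (suc x) + suc (downs x)) % m ≡⟨ cong (_% m) (+-suc (u (suc x)) (downs x)) ⟩
        (suc (u (suc x)) + downs x) % m
          ≡⟨ %-congˡ-+ m (u x) (suc (u (suc x))) (downs x) (Forward⇒% (bounded x) (¬Forward⇒Forward (step x) ¬x→)) ⟨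
        (u x + downs x) % m             ≡⟨ winding x ⟩
        (u 0 + ups x) % m               ∎
      where open ≡-Reasoning

    winding-period : downs k % m ≡ ups k % m
    winding-period = +-cancelˡ-% m (u 0)
        (trans (cong (λ z → (z + downs k) % m) (sym (periodic 0))) (winding k))

    ups-mono : ∀ {x y} → x ≤ y → ups x ≤ ups y
    ups-mono x≤y with m≤n⇒m<n∨m≡n x≤y
    ... | inj₂ refl = ≤-refl
    ups-mono {y = suc y} _ | inj₁ (s≤s x≤y) with forward? (u y) (u (suc y))
    ... | yes _ = m≤n⇒m≤1+n (ups-mono x≤y)
    ... | no _ = ups-mono x≤y

    downs-mono : ∀ {x y} → x ≤ y → downs x ≤ downs y
    downs-mono x≤y with m≤n⇒m<n∨m≡n x≤y
    ... | inj₂ refl = ≤-refl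
    downs-mono {y = suc y} _ | inj₁ (s≤s x≤y) with forward? (u y) (u (suc y))
    ... | yes _ = downs-mono x≤y
    ... | no _ = m≤n⇒m≤1+n (downs-mono x≤y)

    ups-forward : ∀ {x} → Fwd x → ups (suc x) ≡ suc (ups x) × downs (suc x) ≡ downs x
    ups-forward {x} x→ with forward? (u x) (u (suc x))
    ... | yes _ = refl , refl
    ... | no ¬x→ = ⊥-elim (¬x→ x→)

    downs-backward : ∀ {x} → ¬ Fwd x → ups (suc x) ≡ ups x × downs (suc x) ≡ suc (downs x)
    downs-backward {x} ¬x→ with forward? (u x) (u (suc x))
    ... | yes x→ = ⊥-elim (¬x→ x→)
    ... | no _ = refl , refl

    downs≡0⇒forward : ∀ N → downs N ≡ 0 → ∀ {t} → t < N → Fwd t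
    downs≡0⇒forward (suc N) e t<1+N with forward? (u N) (u (suc N)) | m≤n⇒m<n∨m≡n t<1+N
    ... | yes _ | inj₁ (s≤s t<N) = downs≡0⇒forward N e t<N
    ... | yes N→ | inj₂ refl = N→
    downs≡0⇒forward (suc N) () _ | no _ | _

    downs≡1⇒one-backward : ∀ N → downs N ≡ 1 → ∃[ j ] (j < N × ¬ Fwd j × (∀ {t} → t < N → t ≢ j → Fwd t))
    downs≡1⇒one-backward (suc N) e with forward? (u N) (u (suc N))
    ... | yes N→ with downs≡1⇒one-backward N e
    ...   | j , j<N , ¬j→ , others = j , m≤n⇒m≤1+n j<N , ¬j→ , others′
      where
      others′ : ∀ {t} → t < suc N → t ≢ j → Fwd t
      others′ t<1+N t≢j with m≤n⇒m<n∨m≡n t<1+N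
      ... | inj₁ (s≤s t<N) = others t<N t≢j
      ... | inj₂ refl = N→
    downs≡1⇒one-backward (suc N) e | no ¬N→ = N , ≤-refl , ¬N→ , others
      where
      others : ∀ {t} → t < suc N → t ≢ N → Fwd t
      others t<1+N t≢N with m≤n⇒m<n∨m≡n t<1+N
      ... | inj₁ (s≤s t<N) = downs≡0⇒forward N (suc-injective e) t<N
      ... | inj₂ refl = ⊥-elim (t≢N refl)

    crossing-<k : ∀ {a b} → ∃[ t ] SameEdge (u t) (u (suc t)) a b →
        ∃[ t ] (t < k × SameEdge (u t) (u (suc t)) a b)
    crossing-<k (t , e) = t % k , m%n<n t k , subst₂ (λ x y → SameEdge x y _ _)
        (periodic-% periodic t) u-suc e
      where
      u-suc : u (suc t) ≡ u (suc (t % k))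
      u-suc = trans (periodic-% periodic (suc t))
        (trans (cong u (sym ([a+b%d]%d≡[a+b]%d k 1 t))) (sym (periodic-% periodic (suc (t % k)))))

    -- x₀ is a lowest point of the lift u 0 + ups - downs of the walk to ℤ, and height is the lift above it.
    -- For a balanced walk all heights stay below m, so the edge just below u x₀ is never crossed.
    module LowestPoint (balanced : ups k ≡ downs k) (ups<m : ups k < m) {x₀} (x₀≤k : x₀ ≤ k)
                       (x₀-lowest : ∀ x → x ≤ k → ups x₀ + downs x ≤ ups x + downs x₀) where

      -- Abstract so that height is only used through height-spec, where the subtraction is not truncated.
      abstract
        height : ℕ → ℕ
        height x = (ups x + downs x₀) ∸ (ups x₀ + downs x)

        height-spec : ∀ {x} → x ≤ k → ups x + downs x₀ ≡ ups x₀ + downs x + height x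
        height-spec x≤k = sym (m+[n∸m]≡n (x₀-lowest _ x≤k))

      height-≤-ups : ∀ {x} → x ≤ k → ups x + downs x₀ ≤ ups x₀ + downs x + ups k
      height-≤-ups {x} x≤k with ≤-total x₀ x
      ... | inj₁ x₀≤x = ≤-trans (+-mono-≤ (ups-mono x≤k) (downs-mono x₀≤x))
                          (subst (ups k + downs x ≤_) (shuffle (ups x₀) (ups k) (downs x)) (m≤n+m _ (ups x₀)))
        where
        shuffle : ∀ a b c → a + (b + c) ≡ a + c + b
        shuffle = solve-∀
      ... | inj₂ x≤x₀ = ≤-trans (+-monoʳ-≤ (ups x) (downs-mono x₀≤k))
                          (≤-trans (+-monoˡ-≤ (downs k) (ups-mono x≤x₀))
                            (subst (λ z → ups x₀ + z ≤ ups x₀ + downs x + ups k) balanced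
                              (subst (ups x₀ + ups k ≤_) (shuffle (ups x₀) (downs x) (ups k))
                                (+-monoʳ-≤ (ups x₀) (m≤n+m (ups k) (downs x))))))
        where
        shuffle : ∀ a b c → a + (b + c) ≡ a + b + c
        shuffle = solve-∀

      height-<m : ∀ {x} → x ≤ k → height x < m
      height-<m {x} x≤k = ≤-<-trans (+-cancelˡ-≤ (ups x₀ + downs x) _ _
        (subst (_≤ ups x₀ + downs x + ups k) (height-spec x≤k) (height-≤-ups x≤k))) ups<m

      u-height : ∀ {x} → x ≤ k → u x ≡ (u x₀ + height x) % m
      u-height {x} x≤k = trans (sym (m<n⇒m%n≡m (bounded x))) (+-cancelˡ-% m (ups x₀ + downs x) (begin
        (ups x₀ + downs x + u x) % m      ≡⟨ cong (_% m) (shuffle (ups x₀) (downs x) (u x)) ⟩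
        (u x + downs x + ups x₀) % m      ≡⟨ %-congˡ-+ m (u x + downs x) (u 0 + ups x) (ups x₀) (winding x) ⟩
        (u 0 + ups x + ups x₀) % m        ≡⟨ cong (_% m) (shuffle′ (u 0) (ups x) (ups x₀)) ⟩
        (u 0 + ups x₀ + ups x) % m        ≡⟨ %-congˡ-+ m (u x₀ + downs x₀) (u 0 + ups x₀) (ups x) (winding x₀) ⟨
        (u x₀ + downs x₀ + ups x) % m     ≡⟨ cong (_% m) (shuffle″ (u x₀) (downs x₀) (ups x)) ⟩
        (u x₀ + (ups x + downs x₀)) % m   ≡⟨ cong (λ z → (u x₀ + z) % m) (height-spec x≤k) ⟩
        (u x₀ + (ups x₀ + downs x + height x)) % m ≡⟨ cong (_% m) (shuffle‴ (u x₀) (ups x₀ + downs x) (height x)) ⟩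
        (ups x₀ + downs x + (u x₀ + height x)) % m ∎))
        where
        open ≡-Reasoning
        shuffle : ∀ a b c → a + b + c ≡ c + b + a
        shuffle = solve-∀
        shuffle′ : ∀ a b c → a + b + c ≡ a + c + b
        shuffle′ = solve-∀
        shuffle″ : ∀ a b c → a + b + c ≡ a + (c + b)
        shuffle″ = solve-∀
        shuffle‴ : ∀ a b c → a + (b + c) ≡ b + (a + c)
        shuffle‴ = solve-∀

      height-step : ∀ {x} → x < k → height (suc x) ≡ suc (height x) ⊎ height x ≡ suc (height (suc x))
      height-step {x} x<k with toSum (forward? (u x) (u (suc x)))
      ... | inj₁ x→ = inj₁ (+-cancelˡ-≡ (ups x₀ + downs x) (height (suc x)) (suc (height x)) (begin
          ups x₀ + downs x + height (suc x)      ≡⟨ cong (λ z → ups x₀ + z + height (suc x)) (proj₂ (ups-forward x→)) ⟨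
          ups x₀ + downs (suc x) + height (suc x) ≡⟨ height-spec x<k ⟨
          ups (suc x) + downs x₀                 ≡⟨ cong (_+ downs x₀) (proj₁ (ups-forward x→)) ⟩
          suc (ups x + downs x₀)                 ≡⟨ cong suc (height-spec (<⇒≤ x<k)) ⟩
          suc (ups x₀ + downs x + height x)      ≡⟨ +-suc (ups x₀ + downs x) (height x) ⟨
          ups x₀ + downs x + suc (height x)      ∎))
        where open ≡-Reasoning
      ... | inj₂ ¬x→ = inj₂ (+-cancelˡ-≡ (ups x₀ + downs x) (height x) (suc (height (suc x))) (begin
          ups x₀ + downs x + height x             ≡⟨ height-spec (<⇒≤ x<k) ⟨
          ups x + downs x₀                        ≡⟨ cong (_+ downs x₀) (proj₁ (downs-backward ¬x→)) ⟨
          ups (suc x) + downs x₀                  ≡⟨ height-spec x<k ⟩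
          ups x₀ + downs (suc x) + height (suc x) ≡⟨ cong (λ z → ups x₀ + z + height (suc x)) (proj₂ (downs-backward ¬x→)) ⟩
          ups x₀ + suc (downs x) + height (suc x) ≡⟨ cong (_+ height (suc x)) (+-suc (ups x₀) (downs x)) ⟩
          suc (ups x₀ + downs x + height (suc x)) ≡⟨ +-suc (ups x₀ + downs x) (height (suc x)) ⟨
          ups x₀ + downs x + suc (height (suc x)) ∎))
        where open ≡-Reasoning

      height≡0 : ∀ {x} → x ≤ k → u x ≡ u x₀ → height x ≡ 0
      height≡0 {x} x≤k ux = %-injective m (height-<m x≤k) (s≤s z≤n) (sym (+-cancelˡ-% m (u x₀)
        (trans (cong (_% m) (+-identityʳ (u x₀)))
            (trans (m<n⇒m%n≡m (bounded x₀)) (trans (sym ux) (u-height x≤k))))))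

      below-lowest-uncrossed : ∀ {x y} → x ≤ k → y ≤ k →
          height x ≡ suc (height y) ⊎ height y ≡ suc (height x) →
                               u x ≡ cycPred (u x₀) → u y ≡ u x₀ → ⊥
      below-lowest-uncrossed x≤k y≤k steps ux uy with height≡0 y≤k uy | steps
      ... | hy≡0 | inj₂ hy≡1+hx = 0≢1+n (trans (sym hy≡0) hy≡1+hx)
      ... | hy≡0 | inj₁ hx≡1+hy = two-steps≢ {u x₀} (cycPred-<m (bounded x₀))
            (Forward⇒% (bounded x₀) (cycPred-forward (u x₀)))
            (trans (sym (trans (u-height x≤k) (cong (λ z → (u x₀ + z) % m) (trans hx≡1+hy (cong suc hy≡0))))) ux)

      uncovered : ¬ CoversCycle u
      uncovered covers with crossing-<k
          (covers (cycPred-<m (bounded x₀)) (bounded x₀) (Forward⇒cycAdj (cycPred-forward (u x₀))))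
      ... | t , t<k , inj₁ (ut , u1+t) = below-lowest-uncrossed (<⇒≤ t<k) t<k (swap (height-step t<k)) ut u1+t
      ... | t , t<k , inj₂ (u1+t , ut) = below-lowest-uncrossed t<k (<⇒≤ t<k) (height-step t<k) ut u1+t

    module OneBackward {j} (j<k : j < k) (¬j→ : ¬ Fwd j) (others : ∀ {t} → t < k → t ≢ j → Fwd t) where

      forward-after : ∀ {r} → suc r < k → Fwd (suc r + j)
      forward-after {r} 1+r<k with suc r + j <? k
      ... | yes t<k = others t<k (λ e → m+1+n≢m j (trans (+-comm j (suc r)) e))
      ... | no t≮k = subst Fwd t+k≡
            (subst₂ (Forward m) (sym (periodic t)) (sym (periodic (suc t))) (others t<k t≢j))
        where
        t : ℕ
        t = suc r + j ∸ k
        t+k≡ : t + k ≡ suc r + j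
        t+k≡ = m∸n+n≡m (≮⇒≥ t≮k)
        t<k : t < k
        t<k = +-cancelʳ-< k t k (subst (_< k + k) (sym t+k≡) (+-mono-< 1+r<k j<k))
        t≢j : t ≢ j
        t≢j e = <-irrefl (+-cancelʳ-≡ j (suc r) k
            (trans (sym t+k≡) (trans (cong (_+ k) e) (+-comm j k)))) 1+r<k

      c : ℕ
      c = u (suc j)

      u-toCyc : ∀ {r} → r < k → u (r + j) % m ≡ (c + toCyc r) % m
      u-toCyc {zero} _ = trans (Forward⇒% (bounded j) (¬Forward⇒Forward (step j) ¬j→))
          (cong (_% m) (+-comm 1 c))
      u-toCyc {suc zero} _ = cong (_% m) (sym (+-identityʳ c))
      u-toCyc {suc (suc r)} 2+r<k = begin
        u (suc (suc r) + j) % m       ≡⟨ Forward⇒% (bounded _) (forward-after (<⇒≤ 2+r<k)) ⟩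
        (1 + u (suc r + j)) % m       ≡⟨ [a+b%d]%d≡[a+b]%d m 1 (u (suc r + j)) ⟨
        (1 + u (suc r + j) % m) % m   ≡⟨ cong (λ z → (1 + z) % m) (u-toCyc (<⇒≤ 2+r<k)) ⟩
        (1 + (c + r % m) % m) % m     ≡⟨ [a+b%d]%d≡[a+b]%d m 1 (c + r % m) ⟩
        (1 + (c + r % m)) % m         ≡⟨ cong (_% m) (+-suc c (r % m)) ⟨
        (c + (1 + r % m)) % m         ≡⟨ [a+b%d]%d≡[a+b]%d m c (1 + r % m) ⟨
        (c + (1 + r % m) % m) % m     ≡⟨ cong (λ z → (c + z) % m) ([a+b%d]%d≡[a+b]%d m 1 r) ⟩
        (c + suc r % m) % m           ∎
        where open ≡-Reasoning

      u-offset : ∀ {x} → x < k → u x ≡ (c + toCyc (offset j x)) % m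
      u-offset {x} x<k = trans (periodic-% periodic x)
        (trans (cong u (sym (offset+j x (<⇒≤ j<k)))) (trans (sym (periodic-% periodic (offset j x + j)))
        (trans (sym (m<n⇒m%n≡m (bounded (offset j x + j)))) (u-toCyc (offset-<k j x)))))

      sameKernel : SameKernel u (toCyc ∘ offset j)
      sameKernel {x} {y} x<k y<k = to , from
        where
        to : u x ≡ u y → toCyc (offset j x) ≡ toCyc (offset j y)
        to e = %-injective m (toCyc-<m (offset j x)) (toCyc-<m (offset j y))
                 (+-cancelˡ-% m c {toCyc (offset j x)} {toCyc (offset j y)}
                     (trans (sym (u-offset x<k)) (trans e (u-offset y<k))))
        from : toCyc (offset j x) ≡ toCyc (offset j y) → u x ≡ u y
        from e = trans (u-offset x<k) (trans (cong (λ z → (c + z) % m) e) (sym (u-offset y<k)))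

    balanced⇒uncovered : ups k ≡ downs k → ups k < m → ¬ CoversCycle u
    balanced⇒uncovered balanced ups<m with least-difference ups downs k
    ... | x₀ , x₀≤k , x₀-lowest = LowestPoint.uncovered balanced ups<m x₀≤k x₀-lowest

    trichotomy : downs k ≡ 1 ⊎ ups k ≡ 1 ⊎ (ups k ≡ downs k × ups k < m)
    trichotomy = winding-cases (ups k) (downs k) (ups+downs k) winding-period

    downs≡1⇒kernel : downs k ≡ 1 → ∃[ j ] (j < k × SameKernel u (toCyc ∘ offset j))
    downs≡1⇒kernel downs≡1 with downs≡1⇒one-backward k downs≡1
    ... | j , j<k , ¬j→ , others = j , j<k , OneBackward.sameKernel j<k ¬j→ others

  reflect : ℕ → ℕ
  reflect a = (m ∸ a) % m

  reflect-<m : ∀ a → reflect a < m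
  reflect-<m a = m%n<n (m ∸ a) m

  reflect-0 : reflect 0 ≡ 0
  reflect-0 = m%m≡0

  reflect-suc : ∀ {b} → suc b < m → reflect (suc b) ≡ m ∸ suc b
  reflect-suc {b} _ = m<n⇒m%n≡m (s≤s (m∸n≤m (suc (suc n)) b))

  reflect-involutive : ∀ {a} → a < m → reflect (reflect a) ≡ a
  reflect-involutive {zero} _ = trans (cong reflect reflect-0) reflect-0
  reflect-involutive {suc b} a<m =
    trans (cong reflect (reflect-suc a<m)) (trans (cong (_% m) (m∸[m∸n]≡n (<⇒≤ a<m))) (m<n⇒m%n≡m a<m))

  reflect-injective : ∀ {a b} → a < m → b < m → reflect a ≡ reflect b → a ≡ b
  reflect-injective a<m b<m e = trans (sym (reflect-involutive a<m))
      (trans (cong reflect e) (reflect-involutive b<m))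

  reflect-Forward : ∀ {a b} → a < m → b < m → Forward m a b → Forward m (reflect b) (reflect a)
  reflect-Forward {zero} _ b<m (inj₁ refl) = inj₂ (reflect-0 , cong suc (reflect-suc b<m))
  reflect-Forward {suc a} a<m b<m (inj₁ refl) =
    inj₁ (trans (cong suc (reflect-suc b<m)) (trans (sym (+-∸-assoc 1 (<⇒≤ b<m))) (sym (reflect-suc a<m))))
  reflect-Forward {a} _ _ (inj₂ (refl , e)) =
    inj₁ (trans (cong suc reflect-0) (sym (cong (_% m) (trans (cong (_∸ a) (sym e)) (m+n∸n≡m 1 a)))))

  reflect-cycAdj : ∀ {a b} → a < m → b < m → cycAdj m a b → cycAdj m (reflect a) (reflect b)
  reflect-cycAdj a<m b<m ab with cycAdj⇒Forward ab
  ... | inj₁ a→b = cycAdj-sym (Forward⇒cycAdj (reflect-Forward a<m b<m a→b))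
  ... | inj₂ b→a = Forward⇒cycAdj (reflect-Forward b<m a<m b→a)

  reflectWalk : ∀ {u} → ClosedWalk m (cycAdj m) u → ClosedWalk m (cycAdj m) (reflect ∘ u)
  reflectWalk {u} w = record
    { bounded = reflect-<m ∘ u
    ; periodic = cong reflect ∘ periodic
    ; step = λ x → reflect-cycAdj (bounded x) (bounded (suc x)) (step x)
    }
    where open ClosedWalk w

  reflect-downs : ∀ {u} (w : ClosedWalk m (cycAdj m) u) → ∀ x →
      Winding.downs (reflectWalk w) x ≡ Winding.ups w x
  reflect-downs {u} w zero = refl
  reflect-downs {u} w (suc x) with forward? (u x) (u (suc x)) | forward? (reflect (u x)) (reflect (u (suc x)))
  ... | yes x→ | yes rx→ = ⊥-elim (Forward-asym rx→ (reflect-Forward (bounded x) (bounded (suc x)) x→))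
    where open ClosedWalk w
  ... | yes _ | no _ = cong suc (reflect-downs w x)
  ... | no _ | yes _ = reflect-downs w x
  ... | no ¬x→ | no ¬rx→ = ⊥-elim (¬rx→
        (reflect-Forward (bounded (suc x)) (bounded x) (¬Forward⇒Forward (step x) ¬x→)))
    where open ClosedWalk w

  reflect-kernel : ∀ {u f} → (∀ x → u x < m) → SameKernel (reflect ∘ u) f → SameKernel u f
  reflect-kernel bounded ker {x} {y} x<k y<k =
      (λ e → proj₁ (ker x<k y<k) (cong reflect e))
    , (λ e → reflect-injective (bounded x) (bounded y) (proj₂ (ker x<k y<k) e))

  cycWalk-kernel : ∀ {u} → ClosedWalk m (cycAdj m) u → CoversCycle u →
                   ∃[ j ] (j < k × SameKernel u (toCyc ∘ offset j))
  cycWalk-kernel w covers with Winding.trichotomy w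
  ... | inj₁ downs≡1 = Winding.downs≡1⇒kernel w downs≡1
  ... | inj₂ (inj₁ ups≡1) = map₂ (map₂ (reflect-kernel (ClosedWalk.bounded w)))
                               (Winding.downs≡1⇒kernel (reflectWalk w) (trans (reflect-downs w k) ups≡1))
  ... | inj₂ (inj₂ (balanced , ups<m)) = ⊥-elim (Winding.balanced⇒uncovered w balanced ups<m covers)

module Pendant (n : ℕ) where
  open Cycle n
  open Walks n

  SameKernel-cong : ∀ {u f g} → (∀ {x} → x < k → f x ≡ g x) → SameKernel u f → SameKernel u g
  SameKernel-cong f≗g ker x<k y<k =
      (λ e → trans (sym (f≗g x<k)) (trans (proj₁ (ker x<k y<k) e) (f≗g y<k)))
    , (λ e → proj₂ (ker x<k y<k) (trans (f≗g x<k) (trans e (sym (f≗g y<k)))))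

  shiftWalk : ∀ {N E u} s → ClosedWalk N E u → ClosedWalk N E (λ r → u (r + s))
  shiftWalk {u = u} s w = record
    { bounded = λ r → bounded (r + s)
    ; periodic = λ r → trans (cong u (shuffle r k s)) (periodic (r + s))
    ; step = λ r → step (r + s)
    }
    where
    open ClosedWalk w
    shuffle : ∀ a b c → a + b + c ≡ a + c + b
    shuffle = solve-∀

  module _ {N E u} (w : ClosedWalk N E u) {s} (s<k : s < k) where
    open ClosedWalk w

    unshift : ∀ t → u (t + (k ∸ s) + s) ≡ u t
    unshift t = trans (cong u (trans (+-assoc t (k ∸ s) s) (cong (t +_) (m∸n+n≡m (<⇒≤ s<k))))) (periodic t)

    shift-covers : CoversCycle u → CoversCycle (λ r → u (r + s))
    shift-covers covers a<m b<m ab with covers a<m b<m ab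
    ... | t , e = t + (k ∸ s) , subst₂ (λ x y → SameEdge x y _ _) (sym (unshift t)) (sym (unshift (suc t))) e

    shift-kernel : ∀ {f} → SameKernel (λ r → u (r + s)) f → SameKernel u (f ∘ offset s)
    shift-kernel ker {x} {y} x<k y<k =
        (λ e → proj₁ (ker (offset-<k s x) (offset-<k s y))
            (trans (sym (unoffset x<k)) (trans e (unoffset y<k))))
      , (λ e → trans (unoffset x<k)
          (trans (proj₂ (ker (offset-<k s x) (offset-<k s y)) e) (sym (unoffset y<k))))
      where
      unoffset : ∀ {x} → x < k → u x ≡ u (offset s x + s)
      unoffset {x} x<k = trans (periodic-% periodic x)
        (trans (cong u (sym (offset+j x (<⇒≤ s<k)))) (sym (periodic-% periodic (offset s x + s))))

  collapse : ℕ → ℕ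
  collapse a with a ≟ m
  ... | yes _ = 1
  ... | no _ = a

  collapse-pendant : collapse m ≡ 1
  collapse-pendant with m ≟ m
  ... | yes _ = refl
  ... | no m≢m = ⊥-elim (m≢m refl)

  collapse-≢ : ∀ {a} → a ≢ m → collapse a ≡ a
  collapse-≢ {a} a≢m with a ≟ m
  ... | yes a≡m = ⊥-elim (a≢m a≡m)
  ... | no _ = refl

  collapse-<m : ∀ {a} → a < suc m → collapse a < m
  collapse-<m {a} a≤m with a ≟ m
  ... | yes _ = s≤s (s≤s z≤n)
  ... | no a≢m = ≤∧≢⇒< (≤-pred a≤m) a≢m

  collapse-pendAdj : ∀ {a b} → pendAdj m a b → cycAdj m (collapse a) (collapse b)
  collapse-pendAdj (inj₁ (a<m , b<m , ab)) = subst₂ (cycAdj m) (sym (collapse-≢ (<⇒≢ a<m)))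
      (sym (collapse-≢ (<⇒≢ b<m))) ab
  collapse-pendAdj (inj₂ (inj₁ (refl , refl))) = subst₂ (cycAdj m) (sym (collapse-≢ (λ ())))
      (sym collapse-pendant) (inj₁ refl)
  collapse-pendAdj (inj₂ (inj₂ (refl , refl))) = subst₂ (cycAdj m) (sym collapse-pendant)
      (sym (collapse-≢ (λ ()))) (inj₂ (inj₁ refl))

  collapseWalk : ∀ {u} → ClosedWalk (suc m) (pendAdj m) u → ClosedWalk m (cycAdj m) (collapse ∘ u)
  collapseWalk {u} w = record
    { bounded = collapse-<m ∘ bounded
    ; periodic = cong collapse ∘ periodic
    ; step = collapse-pendAdj ∘ step
    }
    where open ClosedWalk w

  collapse-covers : ∀ {u} → CoversCycle u → CoversCycle (collapse ∘ u)
  collapse-covers covers a<m b<m ab with covers a<m b<m ab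
  ... | t , inj₁ (ut , u1+t) = t , inj₁ (trans (cong collapse ut) (collapse-≢ (<⇒≢ a<m))
                                       , trans (cong collapse u1+t) (collapse-≢ (<⇒≢ b<m)))
  ... | t , inj₂ (ut , u1+t) = t , inj₂ (trans (cong collapse ut) (collapse-≢ (<⇒≢ b<m))
                                       , trans (cong collapse u1+t) (collapse-≢ (<⇒≢ a<m)))

  pendAdj-from-pendant : ∀ {b} → pendAdj m m b → b ≡ 0
  pendAdj-from-pendant (inj₁ (m<m , _)) = ⊥-elim (<-irrefl refl m<m)
  pendAdj-from-pendant (inj₂ (inj₁ (() , _)))
  pendAdj-from-pendant (inj₂ (inj₂ (_ , b≡0))) = b≡0

  pendAdj-to-pendant : ∀ {a} → pendAdj m a m → a ≡ 0
  pendAdj-to-pendant = pendAdj-from-pendant ∘ pendAdj-sym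

  offset-0 : ∀ {x} → x < k → offset 0 x ≡ x
  offset-0 {x} x<k = trans (cong (_% k) (+-comm k x)) (trans ([m+n]%n≡m%n x k) (m<n⇒m%n≡m x<k))

  offset-last : ∀ x → offset (suc m) x ≡ x ⊕ 1
  offset-last x = cong (λ z → (z + x) % k) (m+n∸n≡m 1 (suc m))

  toCyc₁ : ℕ → ℕ
  toCyc₁ x = toCyc (x ⊕ 1)

  toCyc₁-≤m : ∀ {r} → r ≤ m → toCyc₁ r ≡ r % m
  toCyc₁-≤m r≤m = cong toCyc (⊕1-< (s≤s (s≤s r≤m)))

  toCyc₁-last : toCyc₁ (suc m) ≡ 1
  toCyc₁-last = cong toCyc last⊕1

  toCycP-0 : ∀ {x y} → toCycP x ≡ toCycP y → x ≡ 0 → y ≡ 0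
  toCycP-0 {zero} {zero} _ _ = refl
  toCycP-0 {zero} {suc y} e _ = ⊥-elim (<⇒≢ (m%n<n y m) (sym e))

  toCyc⇒toCycP : ∀ {x y} → toCyc x ≡ toCyc y → (x ≡ 0 → y ≡ 0) → (y ≡ 0 → x ≡ 0) → toCycP x ≡ toCycP y
  toCyc⇒toCycP {zero} {zero} _ _ _ = refl
  toCyc⇒toCycP {zero} {suc y} _ x0⇒y0 _ with x0⇒y0 refl
  ... | ()
  toCyc⇒toCycP {suc x} {zero} _ _ y0⇒x0 with y0⇒x0 refl
  ... | ()
  toCyc⇒toCycP {suc x} {suc y} e _ _ = e

  toCyc₁⇒toCycP : ∀ {x y} → x < k → y < k → toCyc₁ x ≡ toCyc₁ y → (x ≡ 0 → y ≡ 0) → (y ≡ 0 → x ≡ 0) →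
      toCycP x ≡ toCycP y
  toCyc₁⇒toCycP {zero} {zero} _ _ _ _ _ = refl
  toCyc₁⇒toCycP {zero} {suc y} _ _ _ x0⇒y0 _ with x0⇒y0 refl
  ... | ()
  toCyc₁⇒toCycP {suc x} {zero} _ _ _ _ y0⇒x0 with y0⇒x0 refl
  ... | ()
  toCyc₁⇒toCycP {suc x} {suc y} (s≤s 1+x≤1+m) (s≤s 1+y≤1+m) e _ _
    with m≤n⇒m<n∨m≡n 1+x≤1+m | m≤n⇒m<n∨m≡n 1+y≤1+m
  ... | inj₁ (s≤s 1+x≤m) | inj₁ (s≤s 1+y≤m) =
          +-cancelˡ-% m 1 {x} {y} (trans (sym (toCyc₁-≤m 1+x≤m)) (trans e (toCyc₁-≤m 1+y≤m)))
  ... | inj₂ refl | inj₂ refl = refl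
  ... | inj₁ (s≤s 1+x≤m) | inj₂ refl
      with ≤m-%-≡ 1+x≤m (s≤s z≤n) (trans (sym (toCyc₁-≤m 1+x≤m)) (trans e toCyc₁-last))
  ...   | inj₁ refl = sym m%m≡0
  ...   | inj₂ (inj₁ (() , _))
  ...   | inj₂ (inj₂ (_ , ()))
  toCyc₁⇒toCycP {suc x} {suc y} _ _ e _ _ | inj₂ refl | inj₁ (s≤s 1+y≤m)
      with ≤m-%-≡ 1+y≤m (s≤s z≤n) (trans (sym (toCyc₁-≤m 1+y≤m)) (trans (sym e) toCyc₁-last))
  ...   | inj₁ refl = m%m≡0
  ...   | inj₂ (inj₁ (() , _))
  ...   | inj₂ (inj₂ (_ , ()))

  toCycP⇒toCyc₁ : ∀ {x y} → x < k → y < k → toCycP x ≡ toCycP y → toCyc₁ x ≡ toCyc₁ y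
  toCycP⇒toCyc₁ {zero} {zero} _ _ _ = refl
  toCycP⇒toCyc₁ {zero} {suc y} _ _ e = ⊥-elim (<⇒≢ (m%n<n y m) (sym e))
  toCycP⇒toCyc₁ {suc x} {zero} _ _ e = ⊥-elim (<⇒≢ (m%n<n x m) e)
  toCycP⇒toCyc₁ {suc x} {suc y} (s≤s (s≤s x≤m)) (s≤s (s≤s y≤m)) e with ≤m-%-≡ x≤m y≤m e
  ... | inj₁ refl = refl
  ... | inj₂ (inj₁ (refl , refl)) = sym toCyc₁-last
  ... | inj₂ (inj₂ (refl , refl)) = toCyc₁-last

  toCyc-twin : ∀ {y} → y < k → toCyc y ≡ toCyc 0 → y ≡ 0 ⊎ y ≡ 2
  toCyc-twin {zero} _ _ = inj₁ refl
  toCyc-twin {suc y} (s≤s (s≤s y≤m)) e with ≤m-%-≡ y≤m (s≤s z≤n) e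
  ... | inj₁ refl = inj₂ refl
  ... | inj₂ (inj₁ (_ , ()))
  ... | inj₂ (inj₂ (_ , ()))

  toCyc₁-twin : ∀ {y} → y < k → toCyc₁ y ≡ toCyc₁ 0 → y ≡ 0 ⊎ y ≡ m
  toCyc₁-twin {y} (s≤s y≤1+m) e with m≤n⇒m<n∨m≡n y≤1+m
  ... | inj₁ (s≤s y≤m) with ≤m-%-≡ y≤m z≤n (trans (sym (toCyc₁-≤m y≤m)) e)
  ...   | inj₁ refl = inj₁ refl
  ...   | inj₂ (inj₁ (refl , _)) = inj₁ refl
  ...   | inj₂ (inj₂ (refl , _)) = inj₂ refl
  toCyc₁-twin _ e | inj₂ refl with trans (sym toCyc₁-last) e
  ... | ()

  module PendantAtZero {v} (w : ClosedWalk (suc m) (pendAdj m) v) (v0 : v 0 ≡ m)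
                       {j} (j<k : j < k) (ker : SameKernel (collapse ∘ v) (toCyc ∘ offset j)) where
    open ClosedWalk w

    after-pendant : ∀ {y} → v y ≡ m → v (suc y) ≡ 0
    after-pendant {y} e = pendAdj-from-pendant (subst (λ z → pendAdj m z (v (suc y))) e (step y))

    before-pendant : ∀ {y} → v (suc y) ≡ m → v y ≡ 0
    before-pendant {y} e = pendAdj-to-pendant (subst (pendAdj m (v y)) e (step y))

    v1 : v 1 ≡ 0
    v1 = after-pendant v0

    v-last : v (suc m) ≡ 0
    v-last = before-pendant (trans (periodic 0) v0)

    vq : ℕ → ℕ
    vq = collapse ∘ v

    vq-pendant : ∀ {y} → v y ≡ m → vq y ≡ vq 0
    vq-pendant e = cong collapse (trans e (sym v0))

    -- Both neighbours of the pendant visit are mapped to 0, so the fold of the collapsed walk sits next to it.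
    fold-at-pendant : j ≡ 0 ⊎ j ≡ suc m
    fold-at-pendant = Sum.map fold-0 fold-last (toCyc-fold (offset-<k j (suc m)) (begin
      toCyc (offset j (suc m))       ≡⟨ proj₁ (ker ≤-refl (s≤s (s≤s z≤n))) (cong collapse (trans v-last (sym v1))) ⟩
      toCyc (offset j 1)             ≡⟨ cong (toCyc ∘ offset j) last⊕2 ⟨
      toCyc (offset j (suc m ⊕ 2))   ≡⟨ cong toCyc (offset-⊕ j (suc m) 2) ⟩
      toCyc (offset j (suc m) ⊕ 2)   ∎))
      where
      open ≡-Reasoning
      fold-0 : offset j (suc m) ≡ suc m → j ≡ 0
      fold-0 e = offset-injectiveˡ j<k (s≤s z≤n) ≤-refl (trans e (sym (offset-0 ≤-refl)))
      fold-last : offset j (suc m) ≡ 0 → j ≡ suc m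
      fold-last e = offset-injectiveˡ j<k ≤-refl ≤-refl (trans e (sym (trans (offset-last (suc m)) last⊕1)))

    module Assemble (K : ℕ → ℕ) (ker-K : SameKernel vq K)
                    (toCycP⇒K : ∀ {x y} → x < k → y < k → toCycP x ≡ toCycP y → K x ≡ K y)
                    (K⇒toCycP : ∀ {x y} → x < k → y < k → K x ≡ K y → (x ≡ 0 → y ≡ 0) → (y ≡ 0 → x ≡ 0) →
                                toCycP x ≡ toCycP y)
                    (pendant-once : ∀ {y} → y < k → v y ≡ m → y ≡ 0) where

      non-pendant : ∀ {x} → x < k → x ≢ 0 → vq x ≡ v x
      non-pendant x<k x≢0 = collapse-≢ (x≢0 ∘ pendant-once x<k)

      sameKernel : SameKernel v toCycP
      sameKernel {x} {y} x<k y<k = to , from x<k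
        where
        to : v x ≡ v y → toCycP x ≡ toCycP y
        to e = K⇒toCycP x<k y<k (proj₁ (ker-K x<k y<k) (cong collapse e))
                 (λ { refl → pendant-once y<k (trans (sym e) v0) })
                     (λ { refl → pendant-once x<k (trans e v0) })
        from : ∀ {x} → x < k → toCycP x ≡ toCycP y → v x ≡ v y
        from {zero} _ e = cong v (sym (toCycP-0 e refl))
        from {suc x} 1+x<k e = trans (sym (non-pendant 1+x<k (λ ())))
          (trans (proj₂ (ker-K {suc x} {y} 1+x<k y<k) (toCycP⇒K {suc x} {y} 1+x<k y<k e))
            (non-pendant y<k (λ y≡0 → 0≢1+n (sym (toCycP-0 {y} {suc x} (sym e) y≡0)))))

    -- A second pendant visit could only be at the twin of position 0 (2, resp. m); its outer neighbour
    -- would then be mapped to 0 just like position 1 (resp. k - 1), which the fold does not allow.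
    sameKernel : SameKernel v toCycP
    sameKernel = [ fold-0 , fold-last ]′ fold-at-pendant
      where
      1<k : 1 < k
      1<k = s≤s (s≤s z≤n)
      fold-0 : j ≡ 0 → SameKernel v toCycP
      fold-0 j≡0 = Assemble.sameKernel toCyc ker₀ (λ {x} {y} _ _ → toCycP⇒toCyc x y)
          (λ _ _ → toCyc⇒toCycP) once
        where
        ker₀ : SameKernel vq toCyc
        ker₀ = SameKernel-cong (cong toCyc ∘ offset-0)
            (subst (λ j → SameKernel vq (toCyc ∘ offset j)) j≡0 ker)
        once : ∀ {y} → y < k → v y ≡ m → y ≡ 0
        once y<k e with toCyc-twin y<k (proj₁ (ker₀ y<k (s≤s z≤n)) (vq-pendant e))
        ... | inj₁ y≡0 = y≡0
        ... | inj₂ refl with proj₁ (ker₀ (s≤s (s≤s (s≤s (s≤s z≤n)))) 1<k)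
              (cong collapse (trans (after-pendant e) (sym v1)))
        ...   | ()
      fold-last : j ≡ suc m → SameKernel v toCycP
      fold-last j≡last = Assemble.sameKernel toCyc₁ ker₁ toCycP⇒toCyc₁ toCyc₁⇒toCycP once
        where
        ker₁ : SameKernel vq toCyc₁
        ker₁ = SameKernel-cong (λ {x} _ → cong toCyc (offset-last x))
            (subst (λ j → SameKernel vq (toCyc ∘ offset j)) j≡last ker)
        once : ∀ {y} → y < k → v y ≡ m → y ≡ 0
        once y<k e with toCyc₁-twin y<k (proj₁ (ker₁ y<k (s≤s z≤n)) (vq-pendant e))
        ... | inj₁ y≡0 = y≡0
        ... | inj₂ refl with proj₁ (ker₁ (≤-trans (n≤1+n _) (n≤1+n _)) ≤-refl)
                               (cong collapse (trans (before-pendant e) (sym v-last)))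
        ...   | e′ with trans (sym (trans (toCyc₁-≤m (n≤1+n _)) (m<n⇒m%n≡m (≤-refl {m}))))
              (trans e′ toCyc₁-last)
        ...     | ()

  pendWalk-kernel : ∀ {u} → ClosedWalk (suc m) (pendAdj m) u → CoversCycle u →
                    ∀ {x₀} → x₀ < k → u x₀ ≡ m → SameKernel u (toCycP ∘ offset x₀)
  pendWalk-kernel {u} w covers {x₀} x₀<k ux₀ = pendant-kernel
    (cycWalk-kernel (collapseWalk (shiftWalk x₀ w)) (collapse-covers (shift-covers w x₀<k covers)))
    where
    pendant-kernel : ∃[ j ] (j < k × SameKernel (collapse ∘ (λ r → u (r + x₀))) (toCyc ∘ offset j)) →
                     SameKernel u (toCycP ∘ offset x₀)
    pendant-kernel (j , j<k , ker) = shift-kernel w x₀<k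
        (PendantAtZero.sameKernel (shiftWalk x₀ w) ux₀ j<k ker)

module Families (n : ℕ) where
  open Cycle n
  open Pendant n

  prev : ℕ → ℕ
  prev c = c ⊕ suc m

  prev-<k : ∀ c → prev c < k
  prev-<k c = ⊕-<k c (suc m)

  prev-⊕1 : ∀ {c} → c < k → prev c ⊕ 1 ≡ c
  prev-⊕1 {c} c<k = trans (⊕-⊕ c (suc m) 1) (⊕k c<k)

  prev-suc : ∀ {c} → c < k → prev (c ⊕ 1) ≡ c
  prev-suc {c} c<k = trans (⊕-⊕ c 1 (suc m)) (trans (cong (c ⊕_) (+-comm (suc m) 1)) (⊕k c<k))

  prev-⊕2 : ∀ c → prev c ⊕ 2 ≡ c ⊕ 1
  prev-⊕2 c = trans (⊕-⊕ c (suc m) 2) (trans (⊕-% c (suc k)) (cong (c ⊕_) ([m+n]%n≡m%n 1 k)))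

  offset-prev : ∀ {c} → c < k → offset c (prev c) ≡ suc m
  offset-prev c<k = offset-⊕-cancel (<⇒≤ c<k) ≤-refl

  offset-suc : ∀ {c} → c < k → offset c (c ⊕ 1) ≡ 1
  offset-suc c<k = offset-⊕-cancel (<⇒≤ c<k) (s≤s (s≤s z≤n))

  prev≢ : ∀ {c} → c < k → prev c ≢ c
  prev≢ {c} c<k e with ⊕-injectiveʳ c ≤-refl (s≤s z≤n) (trans e (sym (⊕0 c<k)))
  ... | ()

  suc≢ : ∀ {c} → c < k → c ⊕ 1 ≢ c
  suc≢ {c} c<k e with ⊕-injectiveʳ c (s≤s (s≤s z≤n)) (s≤s z≤n) (trans e (sym (⊕0 c<k)))
  ... | ()

  prev≢suc : ∀ c → prev c ≢ c ⊕ 1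
  prev≢suc c e with ⊕-injectiveʳ c ≤-refl (s≤s (s≤s z≤n)) e
  ... | ()

  offset-prev-shift : ∀ {c x} → c < k → x < k → offset (prev c) x ≡ offset c x ⊕ 1
  offset-prev-shift {c} {x} c<k x<k = begin
    offset (prev c) x                    ≡⟨ cong (offset (prev c)) x≡ ⟨
    offset (prev c) (prev c ⊕ (s ⊕ 1))   ≡⟨ offset-⊕-cancel (<⇒≤ (prev-<k c)) (⊕-<k s 1) ⟩
    s ⊕ 1                                ∎
    where
    open ≡-Reasoning
    s : ℕ
    s = offset c x
    x≡ : prev c ⊕ (s ⊕ 1) ≡ x
    x≡ = begin
      prev c ⊕ (s ⊕ 1)     ≡⟨ ⊕-% (prev c) (1 + s) ⟨
      prev c ⊕ (1 + s)     ≡⟨ cong (prev c ⊕_) (+-comm 1 s) ⟩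
      prev c ⊕ (s + 1)     ≡⟨ ⊕-⊕ (prev c) 1 s ⟨
      (prev c ⊕ 1) ⊕ s     ≡⟨ cong (_⊕ s) (prev-⊕1 c<k) ⟩
      c ⊕ s                ≡⟨ ⊕-offset-cancel (<⇒≤ c<k) x<k ⟩
      x                    ∎

  foldAt pendantAt : ℕ → ℕ → ℕ
  foldAt c = toCyc ∘ offset c
  pendantAt c = toCycP ∘ offset c

  foldAt-merges : ∀ {c} → c < k → foldAt c (prev c) ≡ foldAt c (c ⊕ 1)
  foldAt-merges c<k = trans (cong toCyc (offset-prev c<k)) (trans m%m≡0 (cong toCyc (sym (offset-suc c<k))))

  pendantAt-merges : ∀ {c} → c < k → pendantAt c (prev c) ≡ pendantAt c (c ⊕ 1)
  pendantAt-merges c<k = trans (cong toCycP (offset-prev c<k))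
      (trans m%m≡0 (cong toCycP (sym (offset-suc c<k))))

  private
    offset-suc-prev : ∀ c d → offset d (c ⊕ 1) ≡ offset d (prev c) ⊕ 2
    offset-suc-prev c d = trans (cong (offset d) (sym (prev-⊕2 c))) (offset-⊕ d (prev c) 2)

  foldAt-merges⇒ : ∀ {c d} → c < k → d < k → foldAt d (prev c) ≡ foldAt d (c ⊕ 1) → d ≡ c ⊎ d ≡ prev c
  foldAt-merges⇒ {c} {d} c<k d<k e
    with toCyc-fold (offset-<k d (prev c)) (trans e (cong toCyc (offset-suc-prev c d)))
  ... | inj₁ e′ = inj₁ (offset-injectiveˡ d<k c<k (prev-<k c) (trans e′ (sym (offset-prev c<k))))
  ... | inj₂ e′ = inj₂ (trans (sym (⊕0 d<k))
        (trans (cong (d ⊕_) (sym e′)) (⊕-offset-cancel (<⇒≤ d<k) (prev-<k c))))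

  pendantAt-merges⇒ : ∀ {c d} → c < k → d < k → pendantAt d (prev c) ≡ pendantAt d (c ⊕ 1) → d ≡ c
  pendantAt-merges⇒ {c} {d} c<k d<k e = offset-injectiveˡ d<k c<k (prev-<k c)
    (trans (toCycP-fold (offset-<k d (prev c)) (trans e (cong toCycP (offset-suc-prev c d))))
        (sym (offset-prev c<k)))

  Refines≤k : (ℕ → ℕ) → (ℕ → ℕ) → Set
  Refines≤k f g = ∀ {x y} → x < k → y < k → f x ≡ f y → g x ≡ g y

  foldAt-injective : ∀ {c d} → c < k → d < k → Refines≤k (foldAt c) (foldAt d) → d ≡ c
  foldAt-injective {c} {d} c<k d<k f⇒g with foldAt-merges⇒ c<k d<k
      (f⇒g (prev-<k c) (⊕-<k c 1) (foldAt-merges c<k))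
  ... | inj₁ d≡c = d≡c
  ... | inj₂ d≡prev with foldAt-merges⇒ (⊕-<k c 1) d<k (f⇒g (prev-<k (c ⊕ 1)) (⊕-<k (c ⊕ 1) 1) merges-c+2)
    where
    merges-c+2 : foldAt c (prev (c ⊕ 1)) ≡ foldAt c ((c ⊕ 1) ⊕ 1)
    merges-c+2 = trans (cong (toCyc ∘ offset c) (trans (prev-suc c<k) (sym (⊕0 c<k))))
      (trans (cong toCyc (offset-⊕-cancel (<⇒≤ c<k) (s≤s z≤n)))
        (cong toCyc
            (sym (trans (cong (offset c) (⊕-⊕ c 1 1)) (offset-⊕-cancel (<⇒≤ c<k) (s≤s (s≤s (s≤s z≤n))))))))
  ...   | inj₁ d≡c+1 = ⊥-elim (prev≢suc c (trans (sym d≡prev) d≡c+1))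
  ...   | inj₂ d≡c = trans d≡c (prev-suc c<k)

  pendantAt-injective : ∀ {c d} → c < k → d < k → Refines≤k (pendantAt c) (pendantAt d) → d ≡ c
  pendantAt-injective {c} c<k d<k f⇒g = pendantAt-merges⇒ c<k d<k
      (f⇒g (prev-<k c) (⊕-<k c 1) (pendantAt-merges c<k))

  pendantAt⇒foldAt : ∀ c → Refines≤k (pendantAt c) (foldAt c)
  pendantAt⇒foldAt c {x} {y} _ _ = toCycP⇒toCyc (offset c x) (offset c y)

  pendantAt⇒foldAt-prev : ∀ {c} → c < k → Refines≤k (pendantAt c) (foldAt (prev c))
  pendantAt⇒foldAt-prev {c} c<k {x} {y} x<k y<k e = trans (cong toCyc (offset-prev-shift c<k x<k))
    (trans (toCycP⇒toCyc₁ (offset-<k c x) (offset-<k c y) e) (cong toCyc (sym (offset-prev-shift c<k y<k))))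

module Counting (n : ℕ) where
  open Cycle n
  open Walks n
  open Pendant n
  open Families n

  Ck : Fin k → Fin k → Set
  Ck = Adj (Cyc k)

  -- Cyc m and CycP m are finGraph m (cycAdj m) and finGraph (suc m) (pendAdj m) by definition.
  finGraph : ℕ → (ℕ → ℕ → Set) → Graph
  finGraph N E = record { V = Fin N ; Adj = λ a b → E (toℕ a) (toℕ b) }

  module Canonical {N} {E : ℕ → ℕ → Set} (E-sym : ∀ {a b} → E a b → E b a)
                   (f : ℕ → ℕ) (f-<N : ∀ r → f r < N)
                   (f-hom : ∀ {r} → r < k → E (f r) (f (r ⊕ 1)))
                   (f-edge-onto : ∀ {a b} → a < N → b < N → E a b → ∃[ r ]
                       (r < k × SameEdge (f r) (f (r ⊕ 1)) a b))
                   (f-onto : ∀ {a} → a < N → ∃[ r ] (r < k × f r ≡ a))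
                   {c} (c<k : c < k) where

    g : ℕ → ℕ
    g = f ∘ offset c

    ψ : Fin k → Fin N
    ψ x = fromℕ< (f-<N (offset c (toℕ x)))

    toℕ-ψ : ∀ x → toℕ (ψ x) ≡ g (toℕ x)
    toℕ-ψ x = toℕ-fromℕ< (f-<N (offset c (toℕ x)))

    edgeAt : ∀ {r} → r < k → Σ (Fin k) λ x → Σ (Fin k) λ y → Ck x y × g (toℕ x) ≡ f r × g (toℕ y) ≡ f (r ⊕ 1)
    edgeAt {r} r<k = fromℕ< (⊕-<k c r) , fromℕ< (⊕-<k (c ⊕ r) 1) ,
      subst₂ (cycAdj k) (sym (toℕ-fromℕ< _)) (sym (toℕ-fromℕ< _)) (cycAdj-⊕1 (⊕-<k c r)) ,
      cong f (trans (cong (offset c) (toℕ-fromℕ< _)) (offset-⊕-cancel (<⇒≤ c<k) r<k)) ,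
      cong f (trans (cong (offset c) (toℕ-fromℕ< _))
               (trans (offset-⊕ c (c ⊕ r) 1) (cong (_⊕ 1) (offset-⊕-cancel (<⇒≤ c<k) r<k))))

    quotientMap : QuotientMap Ck (finGraph N E) (kernel (g ∘ toℕ))
    quotientMap = record
      { map = ψ
      ; rel⇒≡ = λ {x} {y} p → toℕ-injective (trans (toℕ-ψ x) (trans (kernel⇒≡ (g ∘ toℕ) p) (sym (toℕ-ψ y))))
      ; ≡⇒rel = λ {x} {y} e → ≡⇒kernel (g ∘ toℕ) (trans (sym (toℕ-ψ x)) (trans (cong toℕ e) (toℕ-ψ y)))
      ; hom = hom
      ; edge-onto = edge-onto
      ; onto = onto
      }
      where
      hom : ∀ {x y} → Ck x y → E (toℕ (ψ x)) (toℕ (ψ y))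
      hom {x} {y} xy with cycAdj⇒⊕1 (toℕ<n x) (toℕ<n y) xy
      ... | inj₁ y≡x+1 = subst₂ E (sym (toℕ-ψ x))
            (sym (trans (toℕ-ψ y) (cong f (trans (cong (offset c) y≡x+1) (offset-⊕ c (toℕ x) 1)))))
                           (f-hom (offset-<k c (toℕ x)))
      ... | inj₂ x≡y+1 = E-sym (subst₂ E (sym (toℕ-ψ y))
            (sym (trans (toℕ-ψ x) (cong f (trans (cong (offset c) x≡y+1) (offset-⊕ c (toℕ y) 1)))))
                           (f-hom (offset-<k c (toℕ y))))
      edge-onto : ∀ {a b} → E (toℕ a) (toℕ b) → ∃[ x ] ∃[ y ] (Ck x y × ψ x ≡ a × ψ y ≡ b)
      edge-onto {a} {b} ab with f-edge-onto (toℕ<n a) (toℕ<n b) ab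
      ... | r , r<k , inj₁ (fr , fr+1) with edgeAt r<k
      ...   | x , y , xy , gx , gy = x , y , xy , toℕ-injective (trans (toℕ-ψ x) (trans gx fr))
                                              , toℕ-injective (trans (toℕ-ψ y) (trans gy fr+1))
      edge-onto {a} {b} ab | r , r<k , inj₂ (fr , fr+1) with edgeAt r<k
      ...   | x , y , xy , gx , gy = y , x , cycAdj-sym xy , toℕ-injective (trans (toℕ-ψ y) (trans gy fr+1))
                                                      , toℕ-injective (trans (toℕ-ψ x) (trans gx fr))
      onto : ∀ a → ∃[ x ] ψ x ≡ a
      onto a with f-onto (toℕ<n a)
      ... | r , r<k , fr with edgeAt r<k
      ...   | x , _ , _ , gx , _ = x , toℕ-injective (trans (toℕ-ψ x) (trans gx fr))

  foldPartition pendantPartition : ℕ → Partition k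
  foldPartition c = kernel (foldAt c ∘ toℕ)
  pendantPartition c = kernel (pendantAt c ∘ toℕ)

  foldPartition-≅ : ∀ {c} → c < k → Quot Ck (foldPartition c) ≅ Cyc m
  foldPartition-≅ c<k = QuotientMap⇒≅ (Canonical.quotientMap
    cycAdj-sym toCyc toCyc-<m toCyc-hom (cycEdge-onto toCyc (λ _ → refl)) toCyc-onto c<k)

  pendantPartition-≅ : ∀ {c} → c < k → Quot Ck (pendantPartition c) ≅ CycP m
  pendantPartition-≅ c<k = QuotientMap⇒≅ (Canonical.quotientMap
    pendAdj-sym toCycP toCycP-≤m toCycP-hom toCycP-edge-onto toCycP-onto c<k)

  module QuotientWalk {N} {E : ℕ → ℕ → Set} {P : Partition k} (ψ : QuotientMap Ck (finGraph N E) P) where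
    open QuotientMap ψ

    u : ℕ → ℕ
    u x = toℕ (map (x mod k))

    toℕ-mod : ∀ x → toℕ (x mod k) ≡ x % k
    toℕ-mod x = toℕ-fromℕ< (m%n<n x k)

    mod-toℕ : ∀ (x : Fin k) → toℕ x mod k ≡ x
    mod-toℕ x = toℕ-injective (trans (toℕ-mod (toℕ x)) (m<n⇒m%n≡m (toℕ<n x)))

    u-toℕ : ∀ (x : Fin k) → u (toℕ x) ≡ toℕ (map x)
    u-toℕ x = cong (toℕ ∘ map) (mod-toℕ x)

    suc-mod : ∀ x → toℕ (suc x mod k) ≡ toℕ (x mod k) ⊕ 1
    suc-mod x = trans (toℕ-mod (suc x))
        (trans (sym ([a+b%d]%d≡[a+b]%d k 1 x)) (cong (λ z → (1 + z) % k) (sym (toℕ-mod x))))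

    closedWalk : ClosedWalk N E u
    closedWalk = record
      { bounded = λ x → toℕ<n (map (x mod k))
      ; periodic = λ x → cong (toℕ ∘ map)
          (toℕ-injective (trans (toℕ-mod (x + k)) (trans ([m+n]%n≡m%n x k) (sym (toℕ-mod x)))))
      ; step = λ x → hom (subst (cycAdj k (toℕ (x mod k))) (sym (suc-mod x)) (cycAdj-⊕1 (toℕ<n (x mod k))))
      }

    next : ∀ {x y : Fin k} → toℕ y ≡ toℕ x ⊕ 1 → u (suc (toℕ x)) ≡ toℕ (map y)
    next {x} {y} e = cong (toℕ ∘ map)
        (toℕ-injective (trans (suc-mod (toℕ x)) (trans (cong (λ z → toℕ z ⊕ 1) (mod-toℕ x)) (sym e))))

    covers : ∀ {a b} → a < N → b < N → E a b → ∃[ t ] SameEdge (u t) (u (suc t)) a b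
    covers {a} {b} a<N b<N ab
      with edge-onto {fromℕ< a<N} {fromℕ< b<N} (subst₂ E (sym (toℕ-fromℕ< a<N)) (sym (toℕ-fromℕ< b<N)) ab)
    ... | x , y , xy , ψx , ψy = crossing (cycAdj⇒⊕1 (toℕ<n x) (toℕ<n y) xy)
      where
      ψx≡a : toℕ (map x) ≡ a
      ψx≡a = trans (cong toℕ ψx) (toℕ-fromℕ< a<N)
      ψy≡b : toℕ (map y) ≡ b
      ψy≡b = trans (cong toℕ ψy) (toℕ-fromℕ< b<N)
      crossing : toℕ y ≡ toℕ x ⊕ 1 ⊎ toℕ x ≡ toℕ y ⊕ 1 → ∃[ t ] SameEdge (u t) (u (suc t)) a b
      crossing (inj₁ y≡x+1) = toℕ x , inj₁ (trans (u-toℕ x) ψx≡a , trans (next {x} {y} y≡x+1) ψy≡b)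
      crossing (inj₂ x≡y+1) = toℕ y , inj₂ (trans (u-toℕ y) ψy≡b , trans (next {y} {x} x≡y+1) ψx≡a)

    visits : ∀ {a} → a < N → ∃[ x ] (x < k × u x ≡ a)
    visits a<N with onto (fromℕ< a<N)
    ... | x , ψx = toℕ x , toℕ<n x , trans (u-toℕ x) (trans (cong toℕ ψx) (toℕ-fromℕ< a<N))

    ≈kernel : ∀ {f} → SameKernel u f → P ≈P kernel (f ∘ toℕ)
    ≈kernel {f} ker x y = T-ext
      (λ p → ≡⇒kernel (f ∘ toℕ) (proj₁ (ker (toℕ<n x) (toℕ<n y)) (u≡ (rel⇒≡ p))))
      (λ p → ≡⇒rel
          (toℕ-injective
          (trans (sym (u-toℕ x)) (trans (proj₂ (ker (toℕ<n x) (toℕ<n y)) (kernel⇒≡ (f ∘ toℕ) p)) (u-toℕ y)))))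
      where
      u≡ : map x ≡ map y → u (toℕ x) ≡ u (toℕ y)
      u≡ e = trans (u-toℕ x) (trans (cong toℕ e) (sym (u-toℕ y)))

  ≅Cyc⇒foldPartition : ∀ P → Quot Ck P ≅ Cyc m → ∃[ c ] (c < k × P ≈P foldPartition c)
  ≅Cyc⇒foldPartition P iso = map₂ (map₂ ≈kernel) (cycWalk-kernel closedWalk covers)
    where open QuotientWalk {E = cycAdj m} {P} (≅⇒QuotientMap iso)

  ≅CycP⇒pendantPartition : ∀ P → Quot Ck P ≅ CycP m → ∃[ c ] (c < k × P ≈P pendantPartition c)
  ≅CycP⇒pendantPartition P iso = from-pendant-visit (visits {m} ≤-refl)
    where
    open QuotientWalk {E = pendAdj m} {P} (≅⇒QuotientMap iso)
    cycle-covered : CoversCycle u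
    cycle-covered a<m b<m ab = covers (m≤n⇒m≤1+n a<m) (m≤n⇒m≤1+n b<m) (inj₁ (a<m , b<m , ab))
    from-pendant-visit : ∃[ x₀ ] (x₀ < k × u x₀ ≡ m) → ∃[ c ] (c < k × P ≈P pendantPartition c)
    from-pendant-visit (x₀ , x₀<k , ux₀) = x₀ , x₀<k , ≈kernel
        (pendWalk-kernel closedWalk cycle-covered x₀<k ux₀)

  Refines⇒Refines≤k : ∀ {f g} → Refines (kernel (f ∘ toℕ)) (kernel (g ∘ toℕ)) → Refines≤k f g
  Refines⇒Refines≤k {f} {g} f⊑g {x} {y} x<k y<k e =
    subst₂ (λ a b → g a ≡ g b) (toℕ-fromℕ< x<k) (toℕ-fromℕ< y<k)
      (kernel⇒≡ (g ∘ toℕ) (f⊑g _ _ (≡⇒kernel (f ∘ toℕ)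
        (subst₂ (λ a b → f a ≡ f b) (sym (toℕ-fromℕ< x<k)) (sym (toℕ-fromℕ< y<k)) e))))

  Refines≤k⇒Refines : ∀ {f g} → Refines≤k f g → Refines (kernel (f ∘ toℕ)) (kernel (g ∘ toℕ))
  Refines≤k⇒Refines {f} {g} f⊑g x y = ≡⇒kernel (g ∘ toℕ) ∘ f⊑g (toℕ<n x) (toℕ<n y) ∘ kernel⇒≡ (f ∘ toℕ)

  foldPartition-injective : ∀ {c d} → c < k → d < k → foldPartition c ≈P foldPartition d → c ≡ d
  foldPartition-injective c<k d<k e = sym (foldAt-injective c<k d<k
      (Refines⇒Refines≤k λ x y → subst T (e x y)))

  pendantPartition-injective : ∀ {c d} → c < k → d < k → pendantPartition c ≈P pendantPartition d → c ≡ d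
  pendantPartition-injective c<k d<k e = sym (pendantAt-injective c<k d<k
      (Refines⇒Refines≤k λ x y → subst T (e x y)))

  fold-quotients : ExactlyP k (λ P → Quot Ck P ≅ Cyc m)
  fold-quotients = exactly-indexed foldPartition foldPartition-≅ foldPartition-injective ≅Cyc⇒foldPartition

  pendant-quotients : ExactlyP k (λ P → Quot Ck P ≅ CycP m)
  pendant-quotients = exactly-indexed pendantPartition pendantPartition-≅ pendantPartition-injective ≅CycP⇒pendantPartition

  coarsenings : ∀ P → Quot Ck P ≅ CycP m → ExactlyP 2 (λ Q → Refines P Q × (Quot Ck Q ≅ Cyc m))
  coarsenings P iso = coarsenings-of (≅CycP⇒pendantPartition P iso)
    where
    coarsenings-of : ∃[ c ] (c < k × P ≈P pendantPartition c) →
        ExactlyP 2 (λ Q → Refines P Q × (Quot Ck Q ≅ Cyc m))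
    coarsenings-of (c , c<k , P≈) = exactly-two (foldPartition c) (foldPartition (prev c))
      (via (pendantAt⇒foldAt c) , foldPartition-≅ c<k)
      (via (pendantAt⇒foldAt-prev c<k) , foldPartition-≅ (prev-<k c))
      (λ e → prev≢ c<k (sym (foldPartition-injective c<k (prev-<k c) e)))
      (λ Q (P⊑Q , isoQ) → one-of Q P⊑Q (≅Cyc⇒foldPartition Q isoQ))
      where
      via : ∀ {g} → Refines≤k (pendantAt c) g → Refines P (kernel (g ∘ toℕ))
      via r x y = Refines≤k⇒Refines r x y ∘ subst T (P≈ x y)
      one-of : ∀ Q → Refines P Q → ∃[ d ] (d < k × Q ≈P foldPartition d) →
          Q ≈P foldPartition c ⊎ Q ≈P foldPartition (prev c)
      one-of Q P⊑Q (d , d<k , Q≈) =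
        Sum.map (λ d≡c → subst (λ d → Q ≈P foldPartition d) d≡c Q≈)
            (λ d≡prev → subst (λ d → Q ≈P foldPartition d) d≡prev Q≈)
                (foldAt-merges⇒ c<k d<k
                    (Refines⇒Refines≤k {pendantAt c} {foldAt d} pendant⊑fold (prev-<k c) (⊕-<k c 1)
                    (pendantAt-merges c<k)))
        where
        pendant⊑fold : Refines (pendantPartition c) (foldPartition d)
        pendant⊑fold x y = subst T (Q≈ x y) ∘ P⊑Q x y ∘ subst T (sym (P≈ x y))

  refinements : ∀ Q → Quot Ck Q ≅ Cyc m → ExactlyP 2 (λ P → Refines P Q × (Quot Ck P ≅ CycP m))
  refinements Q iso = refinements-of (≅Cyc⇒foldPartition Q iso)
    where
    refinements-of : ∃[ c ] (c < k × Q ≈P foldPartition c) →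
        ExactlyP 2 (λ P → Refines P Q × (Quot Ck P ≅ CycP m))
    refinements-of (c , c<k , Q≈) = exactly-two (pendantPartition c) (pendantPartition (c ⊕ 1))
      (via (pendantAt⇒foldAt c) , pendantPartition-≅ c<k)
      (via pendant-suc⊑fold , pendantPartition-≅ (⊕-<k c 1))
      (λ e → suc≢ c<k (sym (pendantPartition-injective c<k (⊕-<k c 1) e)))
      (λ P (P⊑Q , isoP) → one-of P P⊑Q (≅CycP⇒pendantPartition P isoP))
      where
      via : ∀ {f} → Refines≤k f (foldAt c) → Refines (kernel (f ∘ toℕ)) Q
      via r x y = subst T (sym (Q≈ x y)) ∘ Refines≤k⇒Refines r x y
      pendant-suc⊑fold : Refines≤k (pendantAt (c ⊕ 1)) (foldAt c)
      pendant-suc⊑fold = subst (Refines≤k (pendantAt (c ⊕ 1)) ∘ foldAt) (prev-suc c<k)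
          (pendantAt⇒foldAt-prev (⊕-<k c 1))
      one-of : ∀ P → Refines P Q → ∃[ i ] (i < k × P ≈P pendantPartition i) →
          P ≈P pendantPartition c ⊎ P ≈P pendantPartition (c ⊕ 1)
      one-of P P⊑Q (i , i<k , P≈) =
        Sum.map (λ c≡i → subst (λ i → P ≈P pendantPartition i) (sym c≡i) P≈)
                (λ c≡prev → subst (λ i → P ≈P pendantPartition i)
                    (trans (sym (prev-⊕1 i<k)) (cong (_⊕ 1) (sym c≡prev))) P≈)
                (foldAt-merges⇒ i<k c<k
                    (Refines⇒Refines≤k {pendantAt i} {foldAt c} pendant⊑fold (prev-<k i) (⊕-<k i 1)
                    (pendantAt-merges i<k)))
        where
        pendant⊑fold : Refines (pendantPartition i) (foldPartition c)
        pendant⊑fold x y = subst T (Q≈ x y) ∘ P⊑Q x y ∘ subst T (sym (P≈ x y))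

lemma4p4 : (k : ℕ) → 5 ≤ k →
    (ExactlyP k (λ P → Quot (Adj (Cyc k)) P ≅ CycP (k ∸ 2))
     × ExactlyP k (λ P → Quot (Adj (Cyc k)) P ≅ Cyc (k ∸ 2)))
    × ((∀ P → Quot (Adj (Cyc k)) P ≅ CycP (k ∸ 2) →
          ExactlyP 2 (λ Q → Refines P Q × (Quot (Adj (Cyc k)) Q ≅ Cyc (k ∸ 2))))
     × (∀ Q → Quot (Adj (Cyc k)) Q ≅ Cyc (k ∸ 2) →
          ExactlyP 2 (λ P → Refines P Q × (Quot (Adj (Cyc k)) P ≅ CycP (k ∸ 2)))))
lemma4p4 _ (s≤s (s≤s (s≤s (s≤s (s≤s (z≤n {n})))))) = (pendant-quotients , fold-quotients) ,
    (coarsenings , refinements)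
  where open Counting n
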